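{- For every $n\ge1$ and every simple $n$-braid $x$, the generating function $\sum_{d\ge1}b_{n,d}(x)\,t^d$ is a rational function of $t$.
   Context: $B_n^+$ is the monoid generated by $\sigma_1,\dots,\sigma_{n-1}$ subject to $\sigma_i\sigma_j=\sigma_j\sigma_i$ for $|i-j|\ge 2$ and $\sigma_i\sigma_j\sigma_i=\sigma_j\sigma_i\sigma_j$ for $|i-j|=1$. Define $\Delta_1=1$, $\Delta_n=\sigma_1\cdots\sigma_{n-1}\Delta_{n-1}$; a positive $n$-braid is simple if it left-divides $\Delta_n$. A sequence $(x_1,\dots,x_d)$ of simple $n$-braids is normal if $x_k$ is the left gcd of $\Delta_n$ and $x_k\cdots x_d$ for each $k$. Every positive $n$-braid has a unique normal expression padded on the right by factors $1$; degree at most $d$ means all factors after the $d$th are $1$. $b_{n,d}(x)$ is the number of positive $n$-braids of degree at most $d$ whose $d$th normal factor is $x$. -}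

module Defs where

open import Data.Nat using (ℕ; zero; suc; _+_; _≤_; _<_; _∸_)
open import Data.Integer using (ℤ) renaming (_+_ to _+ℤ_; _*_ to _*ℤ_)
import Data.Integer as ℤ
open import Data.List using (List; []; _∷_; _++_; length)
open import Data.List.Relation.Unary.All using (All)
open import Data.List.Relation.Unary.Any using (Any)
open import Data.List.Relation.Unary.AllPairs using (AllPairs)
open import Data.Vec using (Vec; last)
import Data.Vec as Vec
open import Data.Product using (Σ; ∃; _×_; _,_)
open import Data.Unit using (⊤)
open import Relation.Binary.PropositionalEquality using (_≡_)
open import Relation.Binary.Construct.Closure.Equivalence using (EqClosure)
open import Relation.Nullary using (¬_)

-- Positive braid words.  The letter i : ℕ stands for σ_{i+1}.
-- An n-braid word uses only letters i < n ∸ 1 (i.e. σ_1 … σ_{n-1}).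

Word : Set
Word = List ℕ

Valid : ℕ → Word → Set
Valid n w = All (λ i → i < n ∸ 1) w

data Step : Word → Word → Set where
  -- σ_i σ_j = σ_j σ_i  for |i - j| ≥ 2 (one orientation; symmetry below)
  comm  : ∀ u v i j → 2 + i ≤ j →
          Step (u ++ i ∷ j ∷ v) (u ++ j ∷ i ∷ v)
  braid : ∀ u v i →
          Step (u ++ i ∷ suc i ∷ i ∷ v) (u ++ suc i ∷ i ∷ suc i ∷ v)

-- Equality in the positive braid monoid B_n^+ (congruence generated by
-- the relations; the product is concatenation of words).
infix 4 _≈_
_≈_ : Word → Word → Set
_≈_ = EqClosure Step

LeftDivides : ℕ → Word → Word → Set
LeftDivides n a b = Σ Word λ c → Valid n c × (a ++ c) ≈ b

sigmas : ℕ → Word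
sigmas zero    = []
sigmas (suc k) = sigmas k ++ (k ∷ [])

Δ : ℕ → Word
Δ zero          = []
Δ (suc zero)    = []
Δ (suc (suc k)) = sigmas (suc k) ++ Δ (suc k)

Simple : ℕ → Word → Set
Simple n x = Valid n x × LeftDivides n x (Δ n)

IsLeftGcd : ℕ → Word → Word → Word → Set
IsLeftGcd n g a b =
  LeftDivides n g a × LeftDivides n g b ×
  (∀ h → Valid n h → LeftDivides n h a → LeftDivides n h b → LeftDivides n h g)

prod : ∀ {d} → Vec Word d → Word
prod Vec.[]       = []
prod (x Vec.∷ xs) = x ++ prod xs

Normal : ℕ → ∀ {d} → Vec Word d → Set
Normal n Vec.[]       = ⊤
Normal n (x Vec.∷ xs) =
  Simple n x × IsLeftGcd n x (Δ n) (prod (x Vec.∷ xs)) × Normal n xs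

-- β is a positive n-braid of degree at most d (d = suc k ≥ 1) whose
-- d-th normal factor is x: β has a normal expression (x_1,…,x_d) with x_d = x.
DegLeWithLast : ℕ → ℕ → Word → Word → Set
DegLeWithLast n k x β =
  Σ (Vec Word (suc k)) λ xs →
    Normal n xs × prod xs ≈ β × last xs ≈ x

-- c is the number of positive n-braids (elements of B_n^+, i.e. words up to ≈)
-- satisfying P: an explicit list of c pairwise distinct braids satisfying P
-- which contains (up to ≈) every braid satisfying P.
IsCount : ℕ → (Word → Set) → ℕ → Set
IsCount n P c =
  Σ (List Word) λ L →
    length L ≡ c ×
    All (λ w → Valid n w × P w) L ×
    AllPairs (λ a b → ¬ (a ≈ b)) L ×
    (∀ w → Valid n w → P w → Any (λ v → w ≈ v) L)

-- Formal power series over ℤ (as coefficient sequences ℕ → ℤ) and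
-- polynomials (as coefficient lists, constant term first).

coeff : List ℤ → ℕ → ℤ
coeff []       _       = ℤ.0ℤ
coeff (a ∷ as) zero    = a
coeff (a ∷ as) (suc i) = coeff as i

-- coefficient of t^d in the product Q(t) · F(t):  Σ_{i=0}^{d} q_i f_{d-i}
convCoeff : List ℤ → (ℕ → ℤ) → ℕ → ℤ
convCoeff []       f d       = ℤ.0ℤ
convCoeff (q ∷ qs) f zero    = q *ℤ f zero
convCoeff (q ∷ qs) f (suc d) = (q *ℤ f (suc d)) +ℤ convCoeff qs f d

IsRational : (ℕ → ℤ) → Set
IsRational f =
  Σ (List ℤ) λ P → Σ (List ℤ) λ Q →
    Any (λ q → ¬ (q ≡ ℤ.0ℤ)) Q × (∀ d → convCoeff Q f d ≡ coeff P d)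

seriesFrom1 : (ℕ → ℕ) → ℕ → ℤ
seriesFrom1 b zero    = ℤ.0ℤ
seriesFrom1 b (suc k) = ℤ.+ (b (suc k))

{-# OPTIONS --safe #-}
-- Normality of a sequence of simple braids is a local condition: (x₁, …, x_d) is normal iff
-- every xₖ is simple and xₖ is the head (left gcd with Δ) of xₖ xₖ₊₁, because
-- head(a b) = head(a · head b).  Since the braid word problem is decidable, the simple braids
-- can be listed as a finite set S, and the normal sequences of length d ending in x are the
-- paths of length d − 1 ending in x in a finite graph on S.  Their numbers satisfy
-- c_{d+1} = A c_d for the adjacency matrix A of this graph; as any |S| + 1 vectors of ℤ^S
-- are linearly dependent, d ↦ b_{n,d}(x) satisfies a linear recurrence, so its generating
-- function is rational.
module Submission where

open import Data.Empty using (⊥; ⊥-elim)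
open import Data.List using (List; []; _∷_; _++_; length; map; concatMap; upTo; replicate; filter; deduplicate)
open import Data.List.Properties using (++-assoc; length-++; ++-identityʳ; map-++; length-map; length-replicate)
open import Data.List.Membership.Propositional using (_∈_; find)
open import Data.List.Membership.Propositional.Properties using (∈-map⁺; ∈-concatMap⁺; ∈-upTo⁺; ∈-filter⁺)
open import Data.List.Relation.Binary.Pointwise using (Pointwise; []; _∷_)
open import Data.List.Relation.Unary.All as All using (All; []; _∷_)
open import Data.List.Relation.Unary.All.Properties as All using (++⁺; ++⁻ˡ; ++⁻ʳ; all-filter; filter⁺)
open import Data.List.Relation.Unary.AllPairs as AllPairs using (AllPairs; []; _∷_)
import Data.List.Relation.Unary.AllPairs.Properties as AllPairs
open import Data.List.Relation.Unary.Any as Any using (Any; here; there)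
import Data.List.Relation.Unary.Any.Properties as Any
open import Data.List.Relation.Unary.Unique.Setoid using (Unique)
open import Data.List.Relation.Unary.Unique.DecSetoid.Properties using (deduplicate-!)
open import Data.Nat as Nat using (ℕ; zero; suc; _∸_; _≤_; _<_; z≤n; s≤s; _≤?_; _≟_)
open import Data.Nat.Properties
  using ( ≤-refl; ≤-trans; ≤-pred; ≤-reflexive; <⇒≤; ≰⇒>; n≤1+n; 1+n≰n; m≤m+n; m≤n+m; m<n⇒m<1+n
        ; ≤∧≢⇒<; m+1+n≰m; +-suc; +-identityʳ; suc-injective; m∸n+n≡m)
open import Data.Product using (Σ; _×_; _,_; proj₁; proj₂)
open import Data.Sum using (_⊎_; inj₁; inj₂; swap; [_,_]′)
open import Data.Unit using (⊤; tt)
open import Data.Vec using (Vec; []; _∷_; last; init; _∷ʳ_; initLast)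
open import Data.Vec.Properties using (last-∷ʳ; init-∷ʳ; ∷ʳ-injectiveˡ)
open import Data.Vec.Relation.Binary.Pointwise.Inductive using ([]; _∷_) renaming (Pointwise to VecPointwise)
open import Data.Vec.Relation.Unary.All using ([]; _∷_) renaming (All to VecAll)
open import Function.Bundles using (_⇔_; mk⇔; Equivalence)
open import Relation.Binary.Bundles using (Setoid; DecSetoid)
import Relation.Binary.Construct.Closure.Equivalence as EC
open import Relation.Binary.Construct.Closure.ReflexiveTransitive using (Star; ε; _◅_; _◅◅_)
open import Relation.Binary.Construct.Closure.Symmetric using (SymClosure; fwd; bwd)
open import Relation.Binary.PropositionalEquality
  using (_≡_; _≢_; refl; sym; trans; cong; cong₂; subst; isEquivalence)
open import Relation.Nullary using (yes; no; ¬_; Dec)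

open import Defs

module ListFacts where

  keepIf : ∀ {A P : Set} → Dec P → List A → List A
  keepIf (yes _) xs = xs
  keepIf (no _)  _  = []

  All-insert : ∀ {A : Set} {P : A → Set} C₁ {x} C₂ → P x → All P (C₁ ++ C₂) → All P (C₁ ++ x ∷ C₂)
  All-insert []       C₂ px ps       = px ∷ ps
  All-insert (y ∷ C₁) C₂ px (py ∷ ps) = py ∷ All-insert C₁ C₂ px ps

  All-concatMap : ∀ {A B : Set} {P : B → Set} (f : A → List B) xs →
                  (∀ {y} → y ∈ xs → All P (f y)) → All P (concatMap f xs)
  All-concatMap f xs h = All.concat⁺ (All.map⁺ (All.tabulate h))

  Unique-concatMap : ∀ {A B : Set} (key : B → A) (f : A → List B) xs → AllPairs _≢_ xs →
                     (∀ y → AllPairs _≢_ (f y)) → (∀ y → All (λ b → key b ≡ y) (f y)) →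
                     AllPairs _≢_ (concatMap f xs)
  Unique-concatMap key f xs xs-unique f-unique f-key =
    AllPairs.concat⁺ (All.map⁺ (All.tabulate {xs = xs} (λ {y} _ → f-unique y)))
                     (AllPairs.map⁺ (AllPairs.map disjoint xs-unique))
    where
    disjoint : ∀ {y y′} → y ≢ y′ → All (λ b → All (b ≢_) (f y′)) (f y)
    disjoint y≢y′ =
      All.map (λ b-key → All.map (λ b′-key b≡b′ → y≢y′ (trans (sym b-key) (trans (cong key b≡b′) b′-key))) (f-key _))
              (f-key _)

module PowerSeries where

  open import Data.Integer using (ℤ; _+_; _*_; 0ℤ)
  import Data.Integer.Properties as ℤ

  NonTrivial : List ℤ → Set
  NonTrivial cs = Any (λ c → ¬ c ≡ 0ℤ) cs

  truncation : (ℕ → ℤ) → ℕ → List ℤ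
  truncation h zero    = []
  truncation h (suc m) = h 0 ∷ truncation (λ i → h (suc i)) m

  coeff-truncation-< : ∀ m h d → d < m → coeff (truncation h m) d ≡ h d
  coeff-truncation-< (suc m) h zero    _       = refl
  coeff-truncation-< (suc m) h (suc d) (s≤s l) = coeff-truncation-< m (λ i → h (suc i)) d l

  coeff-truncation-≥ : ∀ m h d → m ≤ d → coeff (truncation h m) d ≡ 0ℤ
  coeff-truncation-≥ zero    h d       _       = refl
  coeff-truncation-≥ (suc m) h (suc d) (s≤s l) = coeff-truncation-≥ m (λ i → h (suc i)) d l

  convCoeff-shift : ∀ (g : ℕ → ℤ) → g 0 ≡ 0ℤ → ∀ Q d → convCoeff Q g (suc d) ≡ convCoeff Q (λ m → g (suc m)) d
  convCoeff-shift g g0≡0 []             d       = refl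
  convCoeff-shift g g0≡0 (q ∷ [])       zero    = ℤ.+-identityʳ (q * g 1)
  convCoeff-shift g g0≡0 (q ∷ q′ ∷ qs)  zero    rewrite g0≡0 | ℤ.*-zeroʳ q′ = ℤ.+-identityʳ (q * g 1)
  convCoeff-shift g g0≡0 (q ∷ qs)       (suc d) = cong (q * g (suc (suc d)) +_) (convCoeff-shift g g0≡0 qs d)

  -- The numerator is the truncation of Q · g below degree M + 1; above it Q · g vanishes.
  recurrence⇒IsRational : ∀ (g : ℕ → ℤ) → g 0 ≡ 0ℤ → ∀ Q → NonTrivial Q → ∀ M →
    (∀ k → convCoeff Q (λ m → g (suc m)) (k Nat.+ M) ≡ 0ℤ) → IsRational g
  recurrence⇒IsRational g g0≡0 Q nt M recur = truncation (convCoeff Q g) (suc M) , Q , nt , agree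
    where
    agree : ∀ d → convCoeff Q g d ≡ coeff (truncation (convCoeff Q g) (suc M)) d
    agree d with d ≤? M
    ... | yes d≤M = sym (coeff-truncation-< (suc M) (convCoeff Q g) d (s≤s d≤M))
    ... | no d≰M  =
      let k = d ∸ suc M
          d≡ : suc (k Nat.+ M) ≡ d
          d≡ = trans (sym (+-suc k M)) (m∸n+n≡m (≰⇒> d≰M))
      in subst (λ t → convCoeff Q g t ≡ coeff (truncation (convCoeff Q g) (suc M)) t) d≡
           (trans (convCoeff-shift g g0≡0 Q (k Nat.+ M))
             (trans (recur k) (sym (coeff-truncation-≥ (suc M) (convCoeff Q g) (suc (k Nat.+ M)) (s≤s (m≤n+m M k))))))

module LinearAlgebra {K : Set} where

  open import Data.Integer using (ℤ; _+_; _*_; -_; _-_; 0ℤ; 1ℤ)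
  import Data.Integer.Properties as ℤ
  open import Data.Integer.Solver using (module +-*-Solver)
  open +-*-Solver
  open ListFacts using (All-insert)
  open PowerSeries using (NonTrivial)

  sumOver : List K → (K → ℤ) → ℤ
  sumOver []      f = 0ℤ
  sumOver (y ∷ C) f = f y + sumOver C f

  combination : List ℤ → List (K → ℤ) → K → ℤ
  combination (c ∷ cs) (v ∷ vs) x = c * v x + combination cs vs x
  combination _        _        x = 0ℤ

  Dependent : List K → List (K → ℤ) → Set
  Dependent C vs = Σ (List ℤ) λ cs →
    length cs ≡ length vs × NonTrivial cs × All (λ x → combination cs vs x ≡ 0ℤ) C

  vanishes-or-pivot : (v : K → ℤ) (C : List K) →
    All (λ y → v y ≡ 0ℤ) C ⊎ Σ (List K) λ C₁ → Σ K λ x → Σ (List K) λ C₂ → C ≡ C₁ ++ x ∷ C₂ × ¬ v x ≡ 0ℤ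
  vanishes-or-pivot v []      = inj₁ []
  vanishes-or-pivot v (y ∷ C) with v y ℤ.≟ 0ℤ
  ... | no vy≢0 = inj₂ ([] , y , C , refl , vy≢0)
  ... | yes vy≡0 with vanishes-or-pivot v C
  ...   | inj₁ v≡0 = inj₁ (vy≡0 ∷ v≡0)
  ...   | inj₂ (C₁ , x , C₂ , eq , vx≢0) = inj₂ (y ∷ C₁ , x , C₂ , cong (y ∷_) eq , vx≢0)

  combination-zeros : ∀ m vs y → combination (replicate m 0ℤ) vs y ≡ 0ℤ
  combination-zeros zero    vs       y = refl
  combination-zeros (suc m) []       y = refl
  combination-zeros (suc m) (v ∷ vs) y rewrite combination-zeros m vs y =
    trans (ℤ.+-identityʳ (0ℤ * v y)) (ℤ.*-zeroˡ (v y))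

  NonTrivial-scale : ∀ a cs → ¬ a ≡ 0ℤ → NonTrivial cs → NonTrivial (map (a *_) cs)
  NonTrivial-scale a (c ∷ cs) a≢0 (here c≢0)  = here (λ e → [ a≢0 , c≢0 ]′ (ℤ.i*j≡0⇒i≡0∨j≡0 a e))
  NonTrivial-scale a (c ∷ cs) a≢0 (there nt) = there (NonTrivial-scale a cs a≢0 nt)

  -- A fraction-free Gaussian elimination step with pivot p at coordinate x.
  module Elimination (p : K → ℤ) (x : K) where

    eliminate : (K → ℤ) → K → ℤ
    eliminate w y = p x * w y - w x * p y

    combination-eliminate : ∀ cs ws y →
      combination cs (map eliminate ws) y ≡ p x * combination cs ws y - combination cs ws x * p y
    combination-eliminate []       ws       y = solve 2 (λ a b → con 0ℤ := a :* con 0ℤ :- con 0ℤ :* b) refl (p x) (p y)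
    combination-eliminate (c ∷ cs) []       y = solve 2 (λ a b → con 0ℤ := a :* con 0ℤ :- con 0ℤ :* b) refl (p x) (p y)
    combination-eliminate (c ∷ cs) (w ∷ ws) y rewrite combination-eliminate cs ws y =
      solve 7 (λ c a b wy wx A B → c :* (a :* wy :- wx :* b) :+ (a :* A :- B :* b)
                                   := a :* (c :* wy :+ A) :- (c :* wx :+ B) :* b)
        refl c (p x) (p y) (w y) (w x) (combination cs ws y) (combination cs ws x)

    combination-scale : ∀ cs ws y → combination (map (p x *_) cs) ws y ≡ p x * combination cs ws y
    combination-scale []       ws       y = sym (ℤ.*-zeroʳ (p x))
    combination-scale (c ∷ cs) []       y = sym (ℤ.*-zeroʳ (p x))
    combination-scale (c ∷ cs) (w ∷ ws) y rewrite combination-scale cs ws y =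
      solve 4 (λ a c wy A → a :* c :* wy :+ a :* A := a :* (c :* wy :+ A))
        refl (p x) c (w y) (combination cs ws y)

  Dependent-eliminate : ∀ (v : K → ℤ) vs C₁ x C₂ → ¬ v x ≡ 0ℤ →
    Dependent (C₁ ++ C₂) (map (Elimination.eliminate v x) vs) → Dependent (C₁ ++ x ∷ C₂) (v ∷ vs)
  Dependent-eliminate v vs C₁ x C₂ vx≢0 (cs , length-cs , nt , vanish) =
    cs′ ,
    cong suc (trans (length-map (v x *_) cs) (trans length-cs (length-map eliminate vs))) ,
    there (NonTrivial-scale (v x) cs vx≢0 nt) ,
    All-insert C₁ C₂ (trans (same x) at-x) (All.map (λ {y} → trans (same y)) vanish)
    where
    open Elimination v x
    Lx = combination cs vs x
    cs′ = - Lx ∷ map (v x *_) cs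
    same : ∀ y → combination cs′ (v ∷ vs) y ≡ combination cs (map eliminate vs) y
    same y rewrite combination-scale cs vs y | combination-eliminate cs vs y =
      solve 4 (λ Lx vy a Ly → (:- Lx) :* vy :+ a :* Ly := a :* Ly :- Lx :* vy)
        refl Lx (v y) (v x) (combination cs vs y)
    at-x : combination cs (map eliminate vs) x ≡ 0ℤ
    at-x rewrite combination-eliminate cs vs x = solve 2 (λ a L → a :* L :- L :* a := con 0ℤ) refl (v x) Lx

  length-insert : ∀ C₁ {x : K} C₂ → length (C₁ ++ x ∷ C₂) ≡ suc (length (C₁ ++ C₂))
  length-insert C₁ C₂ = trans (length-++ C₁) (trans (+-suc (length C₁) (length C₂)) (cong suc (sym (length-++ C₁))))

  Dependent-vanishing : ∀ {v C} vs → All (λ y → v y ≡ 0ℤ) C → Dependent C (v ∷ vs)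
  Dependent-vanishing {v} vs v≡0 =
    1ℤ ∷ replicate (length vs) 0ℤ , cong suc (length-replicate (length vs)) , here (λ ()) ,
    All.map (λ {y} vy≡0 → trans (cong₂ _+_ (ℤ.*-identityˡ (v y)) (combination-zeros (length vs) vs y))
                                (trans (ℤ.+-identityʳ (v y)) vy≡0)) v≡0

  dependent-upTo : ∀ m C vs → length C ≤ m → length C < length vs → Dependent C vs
  dependent-upTo m C (v ∷ vs) lC lvs with vanishes-or-pivot v C
  ... | inj₁ v≡0 = Dependent-vanishing vs v≡0
  dependent-upTo zero    C (v ∷ vs) lC lvs | inj₂ (C₁ , x , C₂ , refl , vx≢0)
    with subst (_≤ 0) (length-insert C₁ C₂) lC
  ... | ()
  dependent-upTo (suc m) C (v ∷ vs) lC lvs | inj₂ (C₁ , x , C₂ , refl , vx≢0) =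
    Dependent-eliminate v vs C₁ x C₂ vx≢0 (dependent-upTo m (C₁ ++ C₂) (map eliminate vs) lC′ lvs′)
    where
    open Elimination v x
    lC′ : length (C₁ ++ C₂) ≤ m
    lC′ = ≤-pred (subst (_≤ suc m) (length-insert C₁ C₂) lC)
    lvs′ : length (C₁ ++ C₂) < length (map eliminate vs)
    lvs′ = subst (length (C₁ ++ C₂) <_) (sym (length-map eliminate vs))
                 (≤-pred (subst (_< suc (length vs)) (length-insert C₁ C₂) lvs))

  dependent : ∀ C vs → length C < length vs → Dependent C vs
  dependent C vs = dependent-upTo (length C) C vs ≤-refl

  sumOver-cong : ∀ D {f g : K → ℤ} → (∀ y → f y ≡ g y) → sumOver D f ≡ sumOver D g
  sumOver-cong []      f≡g = refl
  sumOver-cong (y ∷ D) f≡g = cong₂ _+_ (f≡g y) (sumOver-cong D f≡g)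

  sumOver-+ : ∀ D (f g : K → ℤ) → sumOver D (λ y → f y + g y) ≡ sumOver D f + sumOver D g
  sumOver-+ []      f g = refl
  sumOver-+ (y ∷ D) f g rewrite sumOver-+ D f g =
    solve 4 (λ a b c d → a :+ b :+ (c :+ d) := a :+ c :+ (b :+ d)) refl (f y) (g y) (sumOver D f) (sumOver D g)

  sumOver-scale : ∀ D c (f : K → ℤ) → sumOver D (λ y → c * f y) ≡ c * sumOver D f
  sumOver-scale []      c f = sym (ℤ.*-zeroʳ c)
  sumOver-scale (y ∷ D) c f rewrite sumOver-scale D c f = sym (ℤ.*-distribˡ-+ c (f y) (sumOver D f))

  sumOver-vanishing : ∀ D (c g : K → ℤ) → All (λ y → g y ≡ 0ℤ) D → sumOver D (λ y → c y * g y) ≡ 0ℤ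
  sumOver-vanishing []      c g []         = refl
  sumOver-vanishing (y ∷ D) c g (gy≡0 ∷ g≡0)
    rewrite gy≡0 | sumOver-vanishing D c g g≡0 | ℤ.*-zeroʳ (c y) = refl

  -- The length C + 1 vectors w 0, …, w (length C) are dependent on C, and applying the
  -- matrix A carries this relation to every later window: a linear recurrence for w.
  module Iteration (C : List K) (A : K → K → ℤ) (w : ℕ → K → ℤ)
                   (w-suc : ∀ k z → w (suc k) z ≡ sumOver C (λ y → A y z * w k y)) where

    apply : (K → ℤ) → K → ℤ
    apply v z = sumOver C (λ y → A y z * v y)

    window : ℕ → ℕ → List (K → ℤ)
    window k zero    = w k ∷ []
    window k (suc j) = w (k Nat.+ suc j) ∷ window k j

    length-window : ∀ k j → length (window k j) ≡ suc j
    length-window k zero    = refl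
    length-window k (suc j) = cong suc (length-window k j)

    Applied : List (K → ℤ) → List (K → ℤ) → Set
    Applied = Pointwise (λ v v′ → ∀ z → v′ z ≡ apply v z)

    window-suc : ∀ k j → Applied (window k j) (window (suc k) j)
    window-suc k zero    = w-suc k ∷ []
    window-suc k (suc j) = w-suc (k Nat.+ suc j) ∷ window-suc k j

    combination-apply : ∀ cs {ws ws′} → Applied ws ws′ → ∀ z → combination cs ws′ z ≡ apply (combination cs ws) z
    combination-apply []       _  z = sym (sumOver-vanishing C (λ y → A y z) (λ _ → 0ℤ) (All.tabulate (λ _ → refl)))
    combination-apply (c ∷ cs) [] z = sym (sumOver-vanishing C (λ y → A y z) (λ _ → 0ℤ) (All.tabulate (λ _ → refl)))
    combination-apply (c ∷ cs) {v ∷ ws} (v′≡Av ∷ ap) z rewrite v′≡Av z | combination-apply cs ap z =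
      trans (cong (_+ apply (combination cs ws) z) (sym (sumOver-scale C c (λ y → A y z * v y))))
            (trans (sym (sumOver-+ C (λ y → c * (A y z * v y)) (λ y → A y z * combination cs ws y)))
                   (sumOver-cong C (λ y → solve 4 (λ c a b L → c :* (a :* b) :+ a :* L := a :* (c :* b :+ L))
                                                  refl c (A y z) (v y) (combination cs ws y))))

    window-vanishing : ∀ cs j → All (λ y → combination cs (window 0 j) y ≡ 0ℤ) C →
                       ∀ k → All (λ y → combination cs (window k j) y ≡ 0ℤ) C
    window-vanishing cs j vanish zero    = vanish
    window-vanishing cs j vanish (suc k) =
      All.tabulate (λ {y} _ → trans (combination-apply cs (window-suc k j) y)
                                    (sumOver-vanishing C (λ y′ → A y′ y) _ (window-vanishing cs j vanish k)))

    convCoeff-window : ∀ x k j cs → length cs ≡ suc j →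
                       convCoeff cs (λ m → w m x) (k Nat.+ j) ≡ combination cs (window k j) x
    convCoeff-window x zero    zero    (c ∷ []) refl = sym (ℤ.+-identityʳ (c * w 0 x))
    convCoeff-window x (suc k) zero    (c ∷ []) refl rewrite +-identityʳ k = refl
    convCoeff-window x k       (suc j) (c ∷ cs) eq   rewrite +-suc k j =
      cong (c * w (suc (k Nat.+ j)) x +_) (convCoeff-window x k j cs (suc-injective eq))

    recurrence : ∀ x → x ∈ C → Σ (List ℤ) λ Q → NonTrivial Q ×
                 ∀ k → convCoeff Q (λ m → w m x) (k Nat.+ length C) ≡ 0ℤ
    recurrence x x∈C =
      let M = length C
          (cs , length-cs , nt , vanish) = dependent C (window 0 M) (subst (M <_) (sym (length-window 0 M)) ≤-refl)
      in cs , nt , λ k → trans (convCoeff-window x k M cs (trans length-cs (length-window 0 M)))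
                               (All.lookup (window-vanishing cs M vanish k) x∈C)

module Congruence where

  infixr 4 _⟨≈⟩_

  ≈-refl : ∀ {a} → a ≈ a
  ≈-refl = ε

  ≈-sym : ∀ {a b} → a ≈ b → b ≈ a
  ≈-sym = EC.symmetric Step

  _⟨≈⟩_ : ∀ {a b c} → a ≈ b → b ≈ c → a ≈ c
  _⟨≈⟩_ = _◅◅_

  ≡⇒≈ : ∀ {a b} → a ≡ b → a ≈ b
  ≡⇒≈ refl = ε

  ≈-step : ∀ {a b} → Step a b → a ≈ b
  ≈-step s = fwd s ◅ ε

  Step-congˡ : ∀ w {a b} → Step a b → Step (w ++ a) (w ++ b)
  Step-congˡ w (comm u v i j p)
    rewrite sym (++-assoc w u (i ∷ j ∷ v)) | sym (++-assoc w u (j ∷ i ∷ v)) = comm (w ++ u) v i j p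
  Step-congˡ w (braid u v i)
    rewrite sym (++-assoc w u (i ∷ suc i ∷ i ∷ v)) | sym (++-assoc w u (suc i ∷ i ∷ suc i ∷ v)) = braid (w ++ u) v i

  Step-congʳ : ∀ w {a b} → Step a b → Step (a ++ w) (b ++ w)
  Step-congʳ w (comm u v i j p)
    rewrite ++-assoc u (i ∷ j ∷ v) w | ++-assoc u (j ∷ i ∷ v) w = comm u (v ++ w) i j p
  Step-congʳ w (braid u v i)
    rewrite ++-assoc u (i ∷ suc i ∷ i ∷ v) w | ++-assoc u (suc i ∷ i ∷ suc i ∷ v) w = braid u (v ++ w) i

  ++-congˡ : ∀ w {a b} → a ≈ b → w ++ a ≈ w ++ b
  ++-congˡ w = EC.gmap (w ++_) (Step-congˡ w)

  ++-congʳ : ∀ w {a b} → a ≈ b → a ++ w ≈ b ++ w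
  ++-congʳ w = EC.gmap (_++ w) (Step-congʳ w)

  ∷-cong : ∀ c {a b} → a ≈ b → c ∷ a ≈ c ∷ b
  ∷-cong c = ++-congˡ (c ∷ [])

  length-Step : ∀ {a b} → Step a b → length a ≡ length b
  length-Step (comm u v i j p) = trans (length-++ u) (sym (length-++ u))
  length-Step (braid u v i)    = trans (length-++ u) (sym (length-++ u))

  length-≈ : ∀ {a b} → a ≈ b → length a ≡ length b
  length-≈ = EC.gfold isEquivalence length length-Step

module Letters where

  open Congruence
  open Nat using (_+_)

  Distant : ℕ → ℕ → Set
  Distant a b = 2 + a ≤ b ⊎ 2 + b ≤ a

  Adjacent : ℕ → ℕ → Set
  Adjacent a b = suc a ≡ b ⊎ suc b ≡ a

  data Relative (a : ℕ) : ℕ → Set where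
    equal    : Relative a a
    distant  : ∀ {b} → Distant a b → Relative a b
    adjacent : ∀ {b} → Adjacent a b → Relative a b

  Distant-sym : ∀ {a b} → Distant a b → Distant b a
  Distant-sym = swap

  Adjacent-sym : ∀ {a b} → Adjacent a b → Adjacent b a
  Adjacent-sym = swap

  Distant-irrefl : ∀ {a} → Distant a a → ⊥
  Distant-irrefl (inj₁ p) = 1+n≰n (≤-trans (n≤1+n _) p)
  Distant-irrefl (inj₂ p) = 1+n≰n (≤-trans (n≤1+n _) p)

  Adjacent-irrefl : ∀ {a} → Adjacent a a → ⊥
  Adjacent-irrefl (inj₁ ())
  Adjacent-irrefl (inj₂ ())

  Distant⇒¬Adjacent : ∀ {a b} → Distant a b → Adjacent a b → ⊥
  Distant⇒¬Adjacent (inj₁ p) (inj₁ refl) = 1+n≰n (≤-pred p)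
  Distant⇒¬Adjacent (inj₁ p) (inj₂ refl) = 1+n≰n (≤-trans (n≤1+n _) (≤-trans (n≤1+n _) p))
  Distant⇒¬Adjacent (inj₂ p) (inj₁ refl) = 1+n≰n (≤-trans (n≤1+n _) (≤-trans (n≤1+n _) p))
  Distant⇒¬Adjacent (inj₂ p) (inj₂ refl) = 1+n≰n (≤-pred p)

  Adjacent-noTriangle : ∀ {a b c} → Adjacent a b → Adjacent b c → Adjacent a c → ⊥
  Adjacent-noTriangle (inj₁ refl) (inj₁ refl) (inj₁ ())
  Adjacent-noTriangle (inj₁ refl) (inj₁ refl) (inj₂ ())
  Adjacent-noTriangle (inj₁ refl) (inj₂ refl) q = Adjacent-irrefl q
  Adjacent-noTriangle (inj₂ refl) (inj₁ refl) q = Adjacent-irrefl q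
  Adjacent-noTriangle (inj₂ refl) (inj₂ refl) (inj₁ ())
  Adjacent-noTriangle (inj₂ refl) (inj₂ refl) (inj₂ ())

  Relative-suc : ∀ {a b} → Relative a b → Relative (suc a) (suc b)
  Relative-suc equal                  = equal
  Relative-suc (distant (inj₁ p))     = distant (inj₁ (s≤s p))
  Relative-suc (distant (inj₂ p))     = distant (inj₂ (s≤s p))
  Relative-suc (adjacent (inj₁ refl)) = adjacent (inj₁ refl)
  Relative-suc (adjacent (inj₂ refl)) = adjacent (inj₂ refl)

  relative : ∀ a b → Relative a b
  relative zero          zero          = equal
  relative zero          (suc zero)    = adjacent (inj₁ refl)
  relative zero          (suc (suc b)) = distant (inj₁ (s≤s (s≤s z≤n)))
  relative (suc zero)    zero          = adjacent (inj₂ refl)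
  relative (suc (suc a)) zero          = distant (inj₂ (s≤s (s≤s z≤n)))
  relative (suc a)       (suc b)       = Relative-suc (relative a b)

  Relative-sym : ∀ {a b} → Relative a b → Relative b a
  Relative-sym equal        = equal
  Relative-sym (distant p)  = distant (Distant-sym p)
  Relative-sym (adjacent p) = adjacent (Adjacent-sym p)

  distant-comm : ∀ {a b} → Distant a b → ∀ W → a ∷ b ∷ W ≈ b ∷ a ∷ W
  distant-comm {a} {b} (inj₁ p) W = ≈-step (comm [] W a b p)
  distant-comm {a} {b} (inj₂ p) W = ≈-sym (≈-step (comm [] W b a p))

  adjacent-braid : ∀ {a b} → Adjacent a b → ∀ W → a ∷ b ∷ a ∷ W ≈ b ∷ a ∷ b ∷ W
  adjacent-braid {a}           (inj₁ refl) W = ≈-step (braid [] W a)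
  adjacent-braid {.(suc b)} {b} (inj₂ refl) W = ≈-sym (≈-step (braid [] W b))

  -- Garside's lemma (below) says that a ∷ X ≈ b ∷ Y forces X and Y to continue through
  -- the lcm of the letters a and b; ViaLcm r X Y is that conclusion.
  ViaLcm : ∀ {a b} → Relative a b → Word → Word → Set
  ViaLcm equal X Y = X ≈ Y
  ViaLcm {a} {b} (distant _)  X Y = Σ Word λ Z → X ≈ b ∷ Z × Y ≈ a ∷ Z
  ViaLcm {a} {b} (adjacent _) X Y = Σ Word λ Z → X ≈ b ∷ a ∷ Z × Y ≈ a ∷ b ∷ Z

  ViaLcm-irrelevant : ∀ {a b X Y} (r r′ : Relative a b) → ViaLcm r X Y → ViaLcm r′ X Y
  ViaLcm-irrelevant equal        equal         g = g
  ViaLcm-irrelevant equal        (distant p)   g = ⊥-elim (Distant-irrefl p)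
  ViaLcm-irrelevant equal        (adjacent p)  g = ⊥-elim (Adjacent-irrefl p)
  ViaLcm-irrelevant (distant p)  equal         g = ⊥-elim (Distant-irrefl p)
  ViaLcm-irrelevant (distant p)  (distant q)   g = g
  ViaLcm-irrelevant (distant p)  (adjacent q)  g = ⊥-elim (Distant⇒¬Adjacent p q)
  ViaLcm-irrelevant (adjacent p) equal         g = ⊥-elim (Adjacent-irrefl p)
  ViaLcm-irrelevant (adjacent p) (distant q)   g = ⊥-elim (Distant⇒¬Adjacent q p)
  ViaLcm-irrelevant (adjacent p) (adjacent q)  g = g

  ViaLcm-sym : ∀ {a b X Y} (r : Relative a b) → ViaLcm r X Y → ViaLcm (Relative-sym r) Y X
  ViaLcm-sym equal        g           = ≈-sym g
  ViaLcm-sym (distant p)  (Z , x , y) = Z , y , x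
  ViaLcm-sym (adjacent p) (Z , x , y) = Z , y , x

  ViaLcm-respˡ : ∀ {a b X X′ Y} (r : Relative a b) → X ≈ X′ → ViaLcm r X′ Y → ViaLcm r X Y
  ViaLcm-respˡ equal        e g           = e ⟨≈⟩ g
  ViaLcm-respˡ (distant p)  e (Z , x , y) = Z , (e ⟨≈⟩ x) , y
  ViaLcm-respˡ (adjacent p) e (Z , x , y) = Z , (e ⟨≈⟩ x) , y

  ViaLcm-respʳ : ∀ {a b X Y Y′} (r : Relative a b) → ViaLcm r X Y′ → Y′ ≈ Y → ViaLcm r X Y
  ViaLcm-respʳ equal        g           e = g ⟨≈⟩ e
  ViaLcm-respʳ (distant p)  (Z , x , y) e = Z , x , (≈-sym e ⟨≈⟩ y)
  ViaLcm-respʳ (adjacent p) (Z , x , y) e = Z , x , (≈-sym e ⟨≈⟩ y)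

  Step⇒ViaLcm : ∀ {a X b Y} → Step (a ∷ X) (b ∷ Y) → Σ (Relative a b) λ r → ViaLcm r X Y
  Step⇒ViaLcm s = go s refl refl
    where
    go : ∀ {W W′} → Step W W′ → ∀ {a X b Y} → W ≡ a ∷ X → W′ ≡ b ∷ Y → Σ (Relative a b) λ r → ViaLcm r X Y
    go (comm []      v i j p) refl refl = distant (inj₁ p) , v , ≈-refl , ≈-refl
    go (comm (c ∷ u) v i j p) refl refl = equal , ≈-step (comm u v i j p)
    go (braid []      v i)    refl refl = adjacent (inj₁ refl) , v , ≈-refl , ≈-refl
    go (braid (c ∷ u) v i)    refl refl = equal , ≈-step (braid u v i)

module Cancellation where

  open Congruence
  open Letters

  length≤-resp-≈ : ∀ {N A B} → A ≈ B → length A ≤ N → length B ≤ N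
  length≤-resp-≈ e l rewrite length-≈ e = l

  length-SymClosure : ∀ {u v} → SymClosure Step u v → length u ≡ length v
  length-SymClosure (fwd s) = length-Step s
  length-SymClosure (bwd s) = sym (length-Step s)

  SymStep⇒ViaLcm : ∀ {a X b Y} → SymClosure Step (a ∷ X) (b ∷ Y) → Σ (Relative a b) λ r → ViaLcm r X Y
  SymStep⇒ViaLcm (fwd s) = Step⇒ViaLcm s
  SymStep⇒ViaLcm (bwd s) = let (r , g) = Step⇒ViaLcm s in Relative-sym r , ViaLcm-sym r g

  GarsideUpTo : ℕ → Set
  GarsideUpTo N = ∀ {a b A B} → length (a ∷ A) ≤ N → a ∷ A ≈ b ∷ B → (r : Relative a b) → ViaLcm r A B

  -- Garside's argument: ViaLcm composes along a rewriting path; in each case the two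
  -- factorisations are reconciled by applying the lemma to strictly shorter words.
  module Transitivity (N : ℕ) (garsideBelow : GarsideUpTo N) where

    distant-distant : ∀ {a b c} X {V V′} → length X ≤ N → (p1 : Distant a b) (p2 : Distant b c) (r : Relative a c) →
      ViaLcm (distant p1) X V → ViaLcm (distant p2) V V′ → ViaLcm r X V′
    distant-distant {a} {b} X lX p1 p2 equal (Z , xZ , vZ) (T , vT , v′T) =
      let zt = garsideBelow (length≤-resp-≈ xZ lX) (≈-sym vZ ⟨≈⟩ vT) equal
      in xZ ⟨≈⟩ ∷-cong b zt ⟨≈⟩ ≈-sym v′T
    distant-distant {a} {b} {c} X lX p1 p2 (distant p3) (Z , xZ , vZ) (T , vT , v′T) =
      let (U , zU , tU) = garsideBelow (length≤-resp-≈ xZ lX) (≈-sym vZ ⟨≈⟩ vT) (distant p3)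
      in (b ∷ U) ,
         (xZ ⟨≈⟩ ∷-cong b zU ⟨≈⟩ distant-comm p2 U) ,
         (v′T ⟨≈⟩ ∷-cong b tU ⟨≈⟩ distant-comm (Distant-sym p1) U)
    distant-distant {a} {b} {c} X lX p1 p2 (adjacent p3) (Z , xZ , vZ) (T , vT , v′T) =
      let (U , zU , tU) = garsideBelow (length≤-resp-≈ xZ lX) (≈-sym vZ ⟨≈⟩ vT) (adjacent p3)
      in (b ∷ U) ,
         (xZ ⟨≈⟩ ∷-cong b zU ⟨≈⟩ distant-comm p2 (a ∷ U) ⟨≈⟩ ∷-cong c (distant-comm (Distant-sym p1) U)) ,
         (v′T ⟨≈⟩ ∷-cong b tU ⟨≈⟩ distant-comm (Distant-sym p1) (c ∷ U) ⟨≈⟩ ∷-cong a (distant-comm p2 U))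

    distant-adjacent : ∀ {a b c} X {V V′} → length X ≤ N → (p1 : Distant a b) (p2 : Adjacent b c) (r : Relative a c) →
      ViaLcm (distant p1) X V → ViaLcm (adjacent p2) V V′ → ViaLcm r X V′
    distant-adjacent X lX p1 p2 equal g1 g2 = ⊥-elim (Distant⇒¬Adjacent p1 (Adjacent-sym p2))
    distant-adjacent {a} {b} {c} X lX p1 p2 (distant p3) (Z , xZ , vZ) (T , vT , v′T) =
      let e1 = ≈-sym vZ ⟨≈⟩ vT
          (U , zU , tU) = garsideBelow (length≤-resp-≈ xZ lX) e1 (distant p3)
          (W , tW , uW) = garsideBelow (<⇒≤ (length≤-resp-≈ e1 (length≤-resp-≈ xZ lX))) tU (distant (Distant-sym p1))
      in (b ∷ c ∷ W) ,
         (xZ ⟨≈⟩ ∷-cong b zU ⟨≈⟩ ++-congˡ (b ∷ c ∷ []) uW ⟨≈⟩ adjacent-braid p2 W) ,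
         (v′T ⟨≈⟩ ++-congˡ (b ∷ c ∷ []) tW ⟨≈⟩ ∷-cong b (distant-comm (Distant-sym p3) W)
              ⟨≈⟩ distant-comm (Distant-sym p1) (c ∷ W))
    distant-adjacent {a} {b} {c} X lX p1 p2 (adjacent p3) (Z , xZ , vZ) (T , vT , v′T) =
      let e1 = ≈-sym vZ ⟨≈⟩ vT
          (U , zU , tU) = garsideBelow (length≤-resp-≈ xZ lX) e1 (adjacent p3)
          (W1 , tW1 , uW1) = garsideBelow (<⇒≤ (length≤-resp-≈ e1 (length≤-resp-≈ xZ lX))) tU (distant (Distant-sym p1))
          (W , uW , w1W) = garsideBelow (<⇒≤ (length≤-resp-≈ tU (<⇒≤ (length≤-resp-≈ e1 (length≤-resp-≈ xZ lX)))))
                                        uW1 (adjacent (Adjacent-sym p2))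
      in (b ∷ c ∷ a ∷ W) ,
         (xZ ⟨≈⟩ ++-congˡ (b ∷ [])  zU ⟨≈⟩ ++-congˡ (b ∷ c ∷ a ∷ []) uW
             ⟨≈⟩ ++-congˡ (b ∷ c ∷ []) (distant-comm p1 (c ∷ W)) ⟨≈⟩ adjacent-braid p2 (a ∷ c ∷ W)
             ⟨≈⟩ ++-congˡ (c ∷ b ∷ []) (adjacent-braid (Adjacent-sym p3) W)
             ⟨≈⟩ ∷-cong c (distant-comm (Distant-sym p1) (c ∷ a ∷ W))) ,
         (v′T ⟨≈⟩ ++-congˡ (b ∷ c ∷ []) tW1 ⟨≈⟩ ++-congˡ (b ∷ c ∷ a ∷ []) w1W
             ⟨≈⟩ ∷-cong b (adjacent-braid (Adjacent-sym p3) (b ∷ W)) ⟨≈⟩ distant-comm (Distant-sym p1) (c ∷ a ∷ b ∷ W)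
             ⟨≈⟩ ++-congˡ (a ∷ b ∷ c ∷ []) (distant-comm p1 W) ⟨≈⟩ ∷-cong a (adjacent-braid p2 (a ∷ W)))

    adjacent-distant : ∀ {a b c} X {V V′} → length X ≤ N → (p1 : Adjacent a b) (p2 : Distant b c) (r : Relative a c) →
      ViaLcm (adjacent p1) X V → ViaLcm (distant p2) V V′ → ViaLcm r X V′
    adjacent-distant X lX p1 p2 equal g1 g2 = ⊥-elim (Distant⇒¬Adjacent p2 (Adjacent-sym p1))
    adjacent-distant {a} {b} {c} X lX p1 p2 (distant p3) (Z , xZ , vZ) (T , vT , v′T) =
      let e1 = ≈-sym vZ ⟨≈⟩ vT
          (U , zU , tU) = garsideBelow (length≤-resp-≈ xZ lX) e1 (distant p3)
          (W , zW , uW) = garsideBelow (<⇒≤ (length≤-resp-≈ xZ lX)) zU (distant p2)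
      in (b ∷ a ∷ W) ,
         (xZ ⟨≈⟩ ++-congˡ (b ∷ a ∷ []) zW ⟨≈⟩ ∷-cong b (distant-comm p3 W) ⟨≈⟩ distant-comm p2 (a ∷ W)) ,
         (v′T ⟨≈⟩ ∷-cong b tU ⟨≈⟩ ++-congˡ (b ∷ a ∷ []) uW ⟨≈⟩ adjacent-braid (Adjacent-sym p1) W)
    adjacent-distant {a} {b} {c} X lX p1 p2 (adjacent p3) (Z , xZ , vZ) (T , vT , v′T) =
      let e1 = ≈-sym vZ ⟨≈⟩ vT
          (U , zU , tU) = garsideBelow (length≤-resp-≈ xZ lX) e1 (adjacent p3)
          (W1 , zW1 , uW1) = garsideBelow (<⇒≤ (length≤-resp-≈ xZ lX)) zU (distant p2)
          (W , uW , w1W) = garsideBelow (<⇒≤ (length≤-resp-≈ zU (<⇒≤ (length≤-resp-≈ xZ lX)))) uW1 (adjacent p1)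
      in (b ∷ a ∷ c ∷ W) ,
         (xZ ⟨≈⟩ ++-congˡ (b ∷ a ∷ []) zW1 ⟨≈⟩ ++-congˡ (b ∷ a ∷ c ∷ []) w1W
             ⟨≈⟩ ∷-cong b (adjacent-braid p3 (b ∷ W)) ⟨≈⟩ distant-comm p2 (a ∷ c ∷ b ∷ W)
             ⟨≈⟩ ++-congˡ (c ∷ b ∷ a ∷ []) (distant-comm (Distant-sym p2) W)
             ⟨≈⟩ ∷-cong c (adjacent-braid (Adjacent-sym p1) (c ∷ W))) ,
         (v′T ⟨≈⟩ ∷-cong b tU ⟨≈⟩ ++-congˡ (b ∷ a ∷ c ∷ []) uW
             ⟨≈⟩ ++-congˡ (b ∷ a ∷ []) (distant-comm (Distant-sym p2) (a ∷ W))
             ⟨≈⟩ adjacent-braid (Adjacent-sym p1) (c ∷ a ∷ W)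
             ⟨≈⟩ ++-congˡ (a ∷ b ∷ []) (adjacent-braid p3 W) ⟨≈⟩ ∷-cong a (distant-comm p2 (a ∷ c ∷ W)))

    adjacent-adjacent : ∀ {a b c} X {V V′} → length X ≤ N → (p1 : Adjacent a b) (p2 : Adjacent b c) (r : Relative a c) →
      ViaLcm (adjacent p1) X V → ViaLcm (adjacent p2) V V′ → ViaLcm r X V′
    adjacent-adjacent {a} {b} X lX p1 p2 equal (Z , xZ , vZ) (T , vT , v′T) =
      let e1 = garsideBelow (length≤-resp-≈ xZ lX) (≈-sym vZ ⟨≈⟩ vT) equal
          zt = garsideBelow (<⇒≤ (length≤-resp-≈ xZ lX)) e1 equal
      in xZ ⟨≈⟩ ++-congˡ (b ∷ a ∷ []) zt ⟨≈⟩ ≈-sym v′T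
    adjacent-adjacent {a} {b} {c} X lX p1 p2 (distant p3) (Z , xZ , vZ) (T , vT , v′T) =
      let e1 = ≈-sym vZ ⟨≈⟩ vT
          (U , zU , tU) = garsideBelow (length≤-resp-≈ xZ lX) e1 (distant p3)
          (W1 , zW1 , uW1) = garsideBelow (<⇒≤ (length≤-resp-≈ xZ lX)) zU (adjacent p2)
          (W2 , tW2 , uW2) = garsideBelow (<⇒≤ (length≤-resp-≈ e1 (length≤-resp-≈ xZ lX))) tU (adjacent (Adjacent-sym p1))
          lU = <⇒≤ (length≤-resp-≈ zU (<⇒≤ (length≤-resp-≈ xZ lX)))
          e2 = garsideBelow (length≤-resp-≈ uW1 lU) (≈-sym uW1 ⟨≈⟩ uW2) equal
          (W , w1W , w2W) = garsideBelow (<⇒≤ (length≤-resp-≈ uW1 lU)) e2 (distant (Distant-sym p3))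
      in (b ∷ c ∷ a ∷ b ∷ W) ,
         (xZ ⟨≈⟩ ++-congˡ (b ∷ a ∷ []) zW1 ⟨≈⟩ ++-congˡ (b ∷ a ∷ c ∷ b ∷ []) w1W
             ⟨≈⟩ ∷-cong b (distant-comm p3 (b ∷ a ∷ W)) ⟨≈⟩ ++-congˡ (b ∷ c ∷ []) (adjacent-braid p1 W)
             ⟨≈⟩ adjacent-braid p2 (a ∷ b ∷ W)) ,
         (v′T ⟨≈⟩ ++-congˡ (b ∷ c ∷ []) tW2 ⟨≈⟩ ++-congˡ (b ∷ c ∷ a ∷ b ∷ []) w2W
             ⟨≈⟩ ∷-cong b (distant-comm (Distant-sym p3) (b ∷ c ∷ W))
             ⟨≈⟩ ++-congˡ (b ∷ a ∷ []) (adjacent-braid (Adjacent-sym p2) W)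
             ⟨≈⟩ adjacent-braid (Adjacent-sym p1) (c ∷ b ∷ W) ⟨≈⟩ ++-congˡ (a ∷ b ∷ []) (distant-comm p3 (b ∷ W)))
    adjacent-adjacent X lX p1 p2 (adjacent p3) g1 g2 = ⊥-elim (Adjacent-noTriangle p1 p2 p3)

    ViaLcm-trans : ∀ {a b c} X {V V′} → length X ≤ N → (r1 : Relative a b) (r2 : Relative b c) (r3 : Relative a c) →
                   ViaLcm r1 X V → ViaLcm r2 V V′ → ViaLcm r3 X V′
    ViaLcm-trans X lX equal         r2            r3 g1 g2 = ViaLcm-irrelevant r2 r3 (ViaLcm-respˡ r2 g1 g2)
    ViaLcm-trans X lX r1            equal         r3 g1 g2 = ViaLcm-irrelevant r1 r3 (ViaLcm-respʳ r1 g1 g2)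
    ViaLcm-trans X lX (distant p1)  (distant p2)  r3       = distant-distant X lX p1 p2 r3
    ViaLcm-trans X lX (distant p1)  (adjacent p2) r3       = distant-adjacent X lX p1 p2 r3
    ViaLcm-trans X lX (adjacent p1) (distant p2)  r3       = adjacent-distant X lX p1 p2 r3
    ViaLcm-trans X lX (adjacent p1) (adjacent p2) r3       = adjacent-adjacent X lX p1 p2 r3

    ViaLcm-along : ∀ {a X} → length X ≤ N → ∀ {b V W} → Star (SymClosure Step) (b ∷ V) W →
                   Σ (Relative a b) (λ r → ViaLcm r X V) →
                   ∀ {c V′} → W ≡ c ∷ V′ → Σ (Relative a c) (λ r → ViaLcm r X V′)
    ViaLcm-along lX ε g refl = g
    ViaLcm-along lX (_◅_ {j = []} s rest) g eq with length-SymClosure s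
    ... | ()
    ViaLcm-along {a} {X} lX (_◅_ {j = b ∷ V} s rest) (r , g) eq =
      let (r′ , g′) = SymStep⇒ViaLcm s
      in ViaLcm-along lX rest (relative a b , ViaLcm-trans X lX r r′ (relative a b) g g′) eq

  garsideUpTo : ∀ N → GarsideUpTo N
  garsideUpTo zero    ()
  garsideUpTo (suc N) l e r =
    let (r′ , g) = Transitivity.ViaLcm-along N (garsideUpTo N) (≤-pred l) e (equal , ≈-refl) refl
    in ViaLcm-irrelevant r′ r g

  garside : ∀ {a b A B} → a ∷ A ≈ b ∷ B → (r : Relative a b) → ViaLcm r A B
  garside = garsideUpTo _ ≤-refl

  ∷-cancel : ∀ {a A B} → a ∷ A ≈ a ∷ B → A ≈ B
  ∷-cancel e = garside e equal

  ++-cancelˡ : ∀ u {A B} → u ++ A ≈ u ++ B → A ≈ B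
  ++-cancelˡ []      e = e
  ++-cancelˡ (x ∷ u) e = ++-cancelˡ u (∷-cancel e)

module Divisibility where

  open Congruence
  open Letters
  open Cancellation

  infix 4 _≼_
  _≼_ : Word → Word → Set
  a ≼ b = Σ Word λ c → a ++ c ≈ b

  ≼-refl : ∀ {a} → a ≼ a
  ≼-refl {a} = [] , ≡⇒≈ (++-identityʳ a)

  ≼-trans : ∀ {a b c} → a ≼ b → b ≼ c → a ≼ c
  ≼-trans {a} (x , e₁) (y , e₂) = x ++ y , (≡⇒≈ (sym (++-assoc a x y)) ⟨≈⟩ ++-congʳ y e₁ ⟨≈⟩ e₂)

  ≼-≈-trans : ∀ {a b c} → a ≼ b → b ≈ c → a ≼ c
  ≼-≈-trans (x , e₁) e₂ = x , (e₁ ⟨≈⟩ e₂)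

  ≈-≼-trans : ∀ {a b c} → a ≈ b → b ≼ c → a ≼ c
  ≈-≼-trans e₁ (x , e₂) = x , (++-congʳ x e₁ ⟨≈⟩ e₂)

  ≈⇒≼ : ∀ {a b} → a ≈ b → a ≼ b
  ≈⇒≼ = ≼-≈-trans ≼-refl

  u≼u++v : ∀ u {v} → u ≼ u ++ v
  u≼u++v u {v} = v , ≈-refl

  []≼ : ∀ {b} → [] ≼ b
  []≼ {b} = b , ≈-refl

  ++-monoʳ-≼ : ∀ u {a b} → a ≼ b → u ++ a ≼ u ++ b
  ++-monoʳ-≼ u {a} (x , e) = x , (≡⇒≈ (++-assoc u a x) ⟨≈⟩ ++-congˡ u e)

  ++-cancelˡ-≼ : ∀ u {a b} → u ++ a ≼ u ++ b → a ≼ b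
  ++-cancelˡ-≼ u {a} (x , e) = x , ++-cancelˡ u (≡⇒≈ (sym (++-assoc u a x)) ⟨≈⟩ e)

  length-mono-≼ : ∀ {a b} → a ≼ b → length a ≤ length b
  length-mono-≼ {a} (x , e) rewrite sym (length-≈ e) | length-++ a {x} = m≤m+n _ _

  ≼∧length≥⇒≈ : ∀ {a b} → a ≼ b → length b ≤ length a → a ≈ b
  ≼∧length≥⇒≈ {a} ([]    , e) _ = ≡⇒≈ (sym (++-identityʳ a)) ⟨≈⟩ e
  ≼∧length≥⇒≈ {a} (y ∷ x , e) l =
    ⊥-elim (m+1+n≰m (length a) (subst (_≤ length a) (trans (sym (length-≈ e)) (length-++ a)) l))

  module _ {P : ℕ → Set} where
    Step-All : ∀ {a b} → Step a b → All P a → All P b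
    Step-All (comm u v i j p) h with ++⁻ʳ u h
    ... | pi ∷ pj ∷ pv = ++⁺ (++⁻ˡ u h) (pj ∷ pi ∷ pv)
    Step-All (braid u v i) h with ++⁻ʳ u h
    ... | pi ∷ pi+1 ∷ _ ∷ pv = ++⁺ (++⁻ˡ u h) (pi+1 ∷ pi ∷ pi+1 ∷ pv)

    Step-All⁻ : ∀ {a b} → Step a b → All P b → All P a
    Step-All⁻ (comm u v i j p) h with ++⁻ʳ u h
    ... | pj ∷ pi ∷ pv = ++⁺ (++⁻ˡ u h) (pi ∷ pj ∷ pv)
    Step-All⁻ (braid u v i) h with ++⁻ʳ u h
    ... | pi+1 ∷ pi ∷ _ ∷ pv = ++⁺ (++⁻ˡ u h) (pi ∷ pi+1 ∷ pi ∷ pv)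

    All-resp-≈ : ∀ {a b} → a ≈ b → All P a → All P b
    All-resp-≈ ε h = h
    All-resp-≈ (fwd s ◅ r) h = All-resp-≈ r (Step-All s h)
    All-resp-≈ (bwd s ◅ r) h = All-resp-≈ r (Step-All⁻ s h)

    All-resp-≼ : ∀ {a b} → a ≼ b → All P b → All P a
    All-resp-≼ {a} (c , e) h = ++⁻ˡ a (All-resp-≈ (≈-sym e) h)

    All-resp-≼-cofactor : ∀ {a b} → (d : a ≼ b) → All P b → All P (proj₁ d)
    All-resp-≼-cofactor {a} (c , e) h = ++⁻ʳ a (All-resp-≈ (≈-sym e) h)

  complement : ∀ {a b} → Relative a b → Word
  complement equal                 = []
  complement {b = b} (distant _)   = b ∷ []
  complement {a} {b} (adjacent _)  = b ∷ a ∷ []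

  complement-lcm : ∀ {a b} (r : Relative a b) → a ∷ complement r ≈ b ∷ complement (Relative-sym r)
  complement-lcm equal        = ≈-refl
  complement-lcm (distant p)  = distant-comm p []
  complement-lcm (adjacent p) = adjacent-braid p []

  ViaLcm⇒complement : ∀ {a b X Y} (r : Relative a b) → ViaLcm r X Y →
                      Σ Word λ Z → X ≈ complement r ++ Z × Y ≈ complement (Relative-sym r) ++ Z
  ViaLcm⇒complement {Y = Y} equal g = Y , g , ≈-refl
  ViaLcm⇒complement (distant _)  g = g
  ViaLcm⇒complement (adjacent _) g = g

  IsLcm : Word → Word → Word → Set
  IsLcm u v w = u ≼ w × v ≼ w × (∀ m → u ≼ m → v ≼ m → w ≼ m)

  -- With c = complement (relative a b) and c′ its mirror: w₁ = lcm(u, c) satisfies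
  -- a w₁ ≈ b c′ t₁, and then lcm(a ∷ u, b ∷ v) = b ∷ lcm(v, c′ t₁).
  lcm-upTo : ∀ N u v m → length m ≤ N → u ≼ m → v ≼ m → Σ Word (IsLcm u v)
  lcm-upTo N       []      v       m l hu hv = v , []≼ , ≼-refl , (λ _ _ h → h)
  lcm-upTo N       (a ∷ u) []      m l hu hv = a ∷ u , ≼-refl , []≼ , (λ _ h _ → h)
  lcm-upTo zero    (a ∷ u) (b ∷ v) m l (p , e) hv rewrite sym (length-≈ e) with l
  ... | ()
  lcm-upTo (suc N) (a ∷ u) (b ∷ v) m l (p , ep) (q , eq) =
    let r = relative a b
        c′ = complement (Relative-sym r)
        (t , et , _) = ViaLcm⇒complement r (garside (ep ⟨≈⟩ ≈-sym eq) r)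
        (w₁ , u≼w₁ , (t₁ , e₁) , lcm₁) =
          lcm-upTo N u (complement r) (u ++ p) (bound ep) (u≼u++v u) (t , ≈-sym et)
        (t₂ , e₂) = lcm₁ (u ++ p) (u≼u++v u) (t , ≈-sym et)
        aw₁≈bc′t₁ : a ∷ w₁ ≈ b ∷ c′ ++ t₁
        aw₁≈bc′t₁ = ∷-cong a (≈-sym e₁) ⟨≈⟩ ++-congʳ t₁ (complement-lcm r)
        vq≈c′t₁t₂ : v ++ q ≈ (c′ ++ t₁) ++ t₂
        vq≈c′t₁t₂ = ∷-cancel (eq ⟨≈⟩ ≈-sym ep ⟨≈⟩ ∷-cong a (≈-sym e₂) ⟨≈⟩ ++-congʳ t₂ aw₁≈bc′t₁)
        (w₂ , v≼w₂ , c′t₁≼w₂ , lcm₂) =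
          lcm-upTo N v (c′ ++ t₁) (v ++ q) (bound eq) (u≼u++v v) (t₂ , ≈-sym vq≈c′t₁t₂)
        least : ∀ m′ → a ∷ u ≼ m′ → b ∷ v ≼ m′ → b ∷ w₂ ≼ m′
        least m′ (p′ , ep′) (q′ , eq′) =
          let (t′ , et′ , _) = ViaLcm⇒complement r (garside (ep′ ⟨≈⟩ ≈-sym eq′) r)
              w₁≼up′ = lcm₁ (u ++ p′) (u≼u++v u) (t′ , ≈-sym et′)
              bc′t₁≼m′ = ≈-≼-trans (≈-sym aw₁≈bc′t₁) (≼-≈-trans (++-monoʳ-≼ (a ∷ []) w₁≼up′) ep′)
              c′t₁≼vq′ = ++-cancelˡ-≼ (b ∷ []) (≼-≈-trans bc′t₁≼m′ (≈-sym eq′))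
          in ≼-≈-trans (++-monoʳ-≼ (b ∷ []) (lcm₂ (v ++ q′) (u≼u++v v) c′t₁≼vq′)) eq′
    in b ∷ w₂ ,
       ≼-trans (≼-≈-trans (++-monoʳ-≼ (a ∷ []) u≼w₁) aw₁≈bc′t₁) (++-monoʳ-≼ (b ∷ []) c′t₁≼w₂) ,
       ++-monoʳ-≼ (b ∷ []) v≼w₂ ,
       least
    where
    bound : ∀ {c w} → c ∷ w ≈ m → length w ≤ N
    bound e = ≤-pred (subst (_≤ suc N) (sym (length-≈ e)) l)

  lcm : ∀ u v m → u ≼ m → v ≼ m → Σ Word (IsLcm u v)
  lcm u v m = lcm-upTo (length m) u v m ≤-refl

module GarsideElement where

  open Congruence
  open Nat using (_+_)
  open Letters
  open Divisibility

  distant-slide : ∀ c w → All (λ x → 2 + x ≤ c) w → (c ∷ w) ≈ (w ++ c ∷ [])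
  distant-slide c [] h = ≈-refl
  distant-slide c (x ∷ w) (p ∷ h) = distant-comm (inj₂ p) w ⟨≈⟩ ∷-cong x (distant-slide c w h)

  sigmas-letters : ∀ m → All (λ x → x < m) (sigmas m)
  sigmas-letters zero = []
  sigmas-letters (suc m) = ++⁺ (All.map m<n⇒m<1+n (sigmas-letters m)) (≤-refl ∷ [])

  sigmas-shift-letter : ∀ m a → 2 + a ≤ m → (suc a ∷ sigmas m) ≈ (sigmas m ++ a ∷ [])
  sigmas-shift-letter (suc m) a p with m ≟ suc a
  ... | yes refl =
    -- here sigmas m = sigmas a ++ a ∷ suc a ∷ []
    ≡⇒≈ (cong (suc a ∷_) (++-assoc (sigmas a) (a ∷ []) (suc a ∷ [])))
    ⟨≈⟩ ++-congʳ (a ∷ suc a ∷ []) (distant-slide (suc a) (sigmas a) (All.map (λ q → s≤s q) (sigmas-letters a)))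
    ⟨≈⟩ ≡⇒≈ (++-assoc (sigmas a) (suc a ∷ []) (a ∷ suc a ∷ []))
    ⟨≈⟩ ++-congˡ (sigmas a) (≈-sym (adjacent-braid (inj₁ refl) []))
    ⟨≈⟩ ≡⇒≈ (sym (trans (++-assoc (sigmas a ++ a ∷ []) (suc a ∷ []) (a ∷ []))
                        (++-assoc (sigmas a) (a ∷ []) (suc a ∷ a ∷ []))))
  ... | no ne =
    let q : 2 + a ≤ m
        q = ≤∧≢⇒< (≤-pred p) (λ e → ne (sym e))
    in ++-congʳ (m ∷ []) (sigmas-shift-letter m a q)
       ⟨≈⟩ ≡⇒≈ (++-assoc (sigmas m) (a ∷ []) (m ∷ []))
       ⟨≈⟩ ++-congˡ (sigmas m) (distant-comm (inj₁ q) [])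
       ⟨≈⟩ ≡⇒≈ (sym (++-assoc (sigmas m) (m ∷ []) (a ∷ [])))

  sigmas-shift : ∀ m w → All (λ x → 2 + x ≤ m) w → (sigmas m ++ w) ≈ (map suc w ++ sigmas m)
  sigmas-shift m [] h = ≡⇒≈ (++-identityʳ (sigmas m))
  sigmas-shift m (x ∷ w) (p ∷ h) =
    ≡⇒≈ (sym (++-assoc (sigmas m) (x ∷ []) w))
    ⟨≈⟩ ++-congʳ w (≈-sym (sigmas-shift-letter m x p))
    ⟨≈⟩ ∷-cong (suc x) (sigmas-shift m w h)

  sigmas-suc : ∀ k → (0 ∷ map suc (sigmas k)) ≡ sigmas (suc k)
  sigmas-suc zero = refl
  sigmas-suc (suc k) = trans (cong (0 ∷_) (map-++ suc (sigmas k) (k ∷ []))) (cong (_++ (suc k ∷ [])) (sigmas-suc k))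

  Δ-letters : ∀ k → All (λ x → x < k) (Δ (suc k))
  Δ-letters zero = []
  Δ-letters (suc k) = ++⁺ (sigmas-letters (suc k)) (All.map m<n⇒m<1+n (Δ-letters k))

  Δ-conj-letter : ∀ k a → a ≤ k → (a ∷ Δ (2 + k)) ≈ (Δ (2 + k) ++ (k ∸ a) ∷ [])
  Δ-conj-letter zero zero z≤n = ≈-refl
  Δ-conj-letter (suc k) zero z≤n =
    ≡⇒≈ (cong (0 ∷_) (sym (++-assoc (sigmas (2 + k)) (sigmas (suc k)) (Δ (suc k)))))
    ⟨≈⟩ ∷-cong 0 (++-congʳ (Δ (suc k)) (sigmas-shift (2 + k) (sigmas (suc k)) (All.map (λ q → s≤s q) (sigmas-letters (suc k)))))
    ⟨≈⟩ ≡⇒≈ (trans (cong (0 ∷_) (++-assoc (map suc (sigmas (suc k))) (sigmas (2 + k)) (Δ (suc k))))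
                   (cong (_++ (sigmas (2 + k) ++ Δ (suc k))) (sigmas-suc (suc k))))
    ⟨≈⟩ ++-congˡ (sigmas (2 + k)) (≡⇒≈ (++-assoc (sigmas (suc k)) (suc k ∷ []) (Δ (suc k)))
          ⟨≈⟩ ++-congˡ (sigmas (suc k)) (distant-slide (suc k) (Δ (suc k)) (All.map (λ q → s≤s q) (Δ-letters k)))
          ⟨≈⟩ ≡⇒≈ (sym (++-assoc (sigmas (suc k)) (Δ (suc k)) (suc k ∷ []))))
    ⟨≈⟩ ≡⇒≈ (sym (++-assoc (sigmas (2 + k)) (sigmas (suc k) ++ Δ (suc k)) (suc k ∷ [])))
  Δ-conj-letter (suc k) (suc a) (s≤s p) =
    ++-congʳ (Δ (suc (suc k))) (sigmas-shift-letter (2 + k) a (s≤s (s≤s p)))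
    ⟨≈⟩ ≡⇒≈ (++-assoc (sigmas (2 + k)) (a ∷ []) (Δ (2 + k)))
    ⟨≈⟩ ++-congˡ (sigmas (2 + k)) (Δ-conj-letter k a p)
    ⟨≈⟩ ≡⇒≈ (sym (++-assoc (sigmas (2 + k)) (Δ (2 + k)) ((k ∸ a) ∷ [])))

  Δ-valid : ∀ n → Valid n (Δ n)
  Δ-valid zero = []
  Δ-valid (suc n) = Δ-letters n

  Δ-conj : ∀ n w → Valid n w → Σ Word λ w′ → w ++ Δ n ≈ Δ n ++ w′
  Δ-conj n             []      _       = [] , ≡⇒≈ (sym (++-identityʳ (Δ n)))
  Δ-conj (suc (suc k)) (a ∷ w) (p ∷ h) =
    let (w′ , e) = Δ-conj (2 + k) w h
    in (k ∸ a) ∷ w′ ,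
       (∷-cong a e ⟨≈⟩ ++-congʳ w′ (Δ-conj-letter k a (≤-pred p))
                   ⟨≈⟩ ≡⇒≈ (++-assoc (Δ (2 + k)) ((k ∸ a) ∷ []) w′))

  Δ≼w++Δ : ∀ n w → Valid n w → Δ n ≼ w ++ Δ n
  Δ≼w++Δ n w valid-w = let (w′ , e) = Δ-conj n w valid-w in w′ , ≈-sym e

module Decidability where

  open Congruence
  open Letters
  open Cancellation
  open Divisibility

  StartsWith : ℕ → Word → Set
  StartsWith i Y = Σ Word λ Z → Y ≈ i ∷ Z

  []≉∷ : ∀ {i Z} → ¬ [] ≈ i ∷ Z
  []≉∷ e with length-≈ e
  ... | ()

  -- By Garside's lemma, i ∷ Z ≈ j ∷ Y forces Y to start with i (j, i distant) or with i ∷ j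
  -- (j, i adjacent), so the search can peel off j; the fuel N bounds the length of Y.
  startsWith? : ∀ N i Y → length Y ≤ N → Dec (StartsWith i Y)
  startsWith? N       i []      _ = no (λ (Z , e) → []≉∷ e)
  startsWith? zero    i (j ∷ Y) ()
  startsWith? (suc N) i (j ∷ Y) l with relative j i
  ... | equal = yes (Y , ≈-refl)
  ... | distant p with startsWith? N i Y (≤-pred l)
  ...   | yes (Z , e) = yes (j ∷ Z , (∷-cong j e ⟨≈⟩ distant-comm p Z))
  ...   | no ¬i≼Y     = no (λ (_ , e) → let (W , Y≈iW , _) = garside e (distant p) in ¬i≼Y (W , Y≈iW))
  startsWith? (suc N) i (j ∷ Y) l | adjacent p with startsWith? N i Y (≤-pred l)
  ...   | no ¬i≼Y     = no (λ (_ , e) → let (W , Y≈ijW , _) = garside e (adjacent p) in ¬i≼Y (j ∷ W , Y≈ijW))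
  ...   | yes (Z , e) with startsWith? N j Z (<⇒≤ (subst (_≤ N) (length-≈ e) (≤-pred l)))
  ...     | yes (Z′ , e′) = yes (j ∷ i ∷ Z′ , (∷-cong j (e ⟨≈⟩ ∷-cong i e′) ⟨≈⟩ adjacent-braid p Z′))
  ...     | no ¬j≼Z       =
    no (λ (_ , e″) → let (W , Y≈ijW , _) = garside e″ (adjacent p) in ¬j≼Z (W , ∷-cancel (≈-sym e ⟨≈⟩ Y≈ijW)))

  _≼?_ : ∀ a b → Dec (a ≼ b)
  []      ≼? b = yes []≼
  (i ∷ a) ≼? b with startsWith? (length b) i b ≤-refl
  ... | no ¬i≼b = no (λ (c , e) → ¬i≼b (a ++ c , ≈-sym e))
  ... | yes (Z , e) with a ≼? Z
  ...   | yes (c , e′) = yes (c , (∷-cong i e′ ⟨≈⟩ ≈-sym e))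
  ...   | no ¬a≼Z      = no (λ (c , e′) → ¬a≼Z (c , ∷-cancel (e′ ⟨≈⟩ e)))

  _≈?_ : ∀ a b → Dec (a ≈ b)
  a ≈? b with a ≼? b | length b ≤? length a
  ... | yes a≼b | yes l  = yes (≼∧length≥⇒≈ a≼b l)
  ... | no ¬a≼b | _      = no (λ e → ¬a≼b (≈⇒≼ e))
  ... | yes _   | no ¬l  = no (λ e → ¬l (≤-reflexive (sym (length-≈ e))))

  wordSetoid : Setoid _ _
  wordSetoid = EC.setoid Step

  wordDecSetoid : DecSetoid _ _
  wordDecSetoid = record { isDecEquivalence = record { isEquivalence = Setoid.isEquivalence wordSetoid ; _≟_ = _≈?_ } }

  wordsUpTo : ℕ → ℕ → List Word
  wordsUpTo m zero    = [] ∷ []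
  wordsUpTo m (suc L) = [] ∷ concatMap (λ x → map (x ∷_) (wordsUpTo m L)) (upTo m)

  ∈-wordsUpTo : ∀ m L w → All (_< m) w → length w ≤ L → w ∈ wordsUpTo m L
  ∈-wordsUpTo m zero    []      _       _         = here refl
  ∈-wordsUpTo m (suc L) []      _       _         = here refl
  ∈-wordsUpTo m (suc L) (x ∷ w) (p ∷ h) (s≤s l) =
    there (∈-concatMap⁺ (λ y → map (y ∷_) (wordsUpTo m L))
             (Any.map (λ { refl → ∈-map⁺ (x ∷_) (∈-wordsUpTo m L w h l) }) (∈-upTo⁺ p)))

module Heads (n : ℕ) where

  open Congruence
  open Divisibility
  open GarsideElement
  open Decidability

  shortWords : List Word
  shortWords = wordsUpTo (n ∸ 1) (length (Δ n))

  simples : List Word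
  simples = deduplicate _≈?_ (filter (_≼? Δ n) shortWords)

  simples-≼Δ : All (_≼ Δ n) simples
  simples-≼Δ = All.deduplicate⁺ _≈?_ (all-filter (_≼? Δ n) shortWords)

  simples-complete : ∀ {w} → w ≼ Δ n → Any (w ≈_) simples
  simples-complete {w} w≼Δ =
    Any.deduplicate⁺ _≈?_ (λ y≈x w≈x → w≈x ⟨≈⟩ ≈-sym y≈x)
      (Any.map (λ { refl → ≈-refl }) (∈-filter⁺ (_≼? Δ n) w∈shortWords w≼Δ))
    where
    w∈shortWords = ∈-wordsUpTo (n ∸ 1) (length (Δ n)) w (All-resp-≼ w≼Δ (Δ-valid n)) (length-mono-≼ w≼Δ)

  simples-unique : Unique wordSetoid simples
  simples-unique = deduplicate-! wordDecSetoid _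

  simples-≈⇒≡ : ∀ {a b} → a ∈ simples → b ∈ simples → a ≈ b → a ≡ b
  simples-≈⇒≡ = go simples-unique
    where
    go : ∀ {xs a b} → Unique wordSetoid xs → a ∈ xs → b ∈ xs → a ≈ b → a ≡ b
    go (_   ∷ _) (here refl) (here refl) _ = refl
    go (a≉ ∷ _) (here refl) (there b∈)  e = ⊥-elim (All.lookup a≉ b∈ e)
    go (b≉ ∷ _) (there a∈)  (here refl) e = ⊥-elim (All.lookup b≉ a∈ (≈-sym e))
    go (_   ∷ u) (there a∈)  (there b∈)  e = go u a∈ b∈ e

  longest : List Word → Word
  longest []       = []
  longest (x ∷ xs) with length (longest xs) ≤? length x
  ... | yes _ = x
  ... | no  _ = longest xs

  longest-maximal : ∀ xs → All (λ y → length y ≤ length (longest xs)) xs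
  longest-maximal []       = []
  longest-maximal (x ∷ xs) with length (longest xs) ≤? length x
  ... | yes l = ≤-refl ∷ All.map (λ l′ → ≤-trans l′ l) (longest-maximal xs)
  ... | no ¬l = <⇒≤ (≰⇒> ¬l) ∷ longest-maximal xs

  longest-satisfies : ∀ {Q : Word → Set} xs → Q [] → All Q xs → Q (longest xs)
  longest-satisfies []       q[] []       = q[]
  longest-satisfies (x ∷ xs) q[] (q ∷ qs) with length (longest xs) ≤? length x
  ... | yes _ = q
  ... | no  _ = longest-satisfies xs q[] qs

  IsHead : Word → Word → Set
  IsHead β g = g ≼ Δ n × g ≼ β × (∀ h → h ≼ Δ n → h ≼ β → h ≼ g)

  head : Word → Word
  head β = longest (filter (_≼? β) simples)

  -- The longest simple divisor g of β absorbs every simple divisor h of β: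
  -- lcm(g, h) is again a simple divisor of β, no longer than g, hence ≈ g.
  head-IsHead : ∀ β → IsHead β (head β)
  head-IsHead β = g≼Δ , g≼β , greatest
    where
    candidates = filter (_≼? β) simples
    g = head β
    g≼Δ×g≼β : g ≼ Δ n × g ≼ β
    g≼Δ×g≼β = longest-satisfies candidates ([]≼ , []≼)
                (All.zip (filter⁺ (_≼? β) simples-≼Δ , all-filter (_≼? β) simples))
    g≼Δ = proj₁ g≼Δ×g≼β
    g≼β = proj₂ g≼Δ×g≼β
    greatest : ∀ h → h ≼ Δ n → h ≼ β → h ≼ g
    greatest h h≼Δ h≼β =
      let (L , g≼L , h≼L , least) = lcm g h (Δ n) g≼Δ h≼Δ
          (s , s∈simples , L≈s) = find (simples-complete (least (Δ n) g≼Δ h≼Δ))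
          s≼β = ≈-≼-trans (≈-sym L≈s) (least β g≼β h≼β)
          s≤g = All.lookup (longest-maximal candidates) (∈-filter⁺ (_≼? β) s∈simples s≼β)
          g≈L = ≼∧length≥⇒≈ g≼L (subst (_≤ length g) (sym (length-≈ L≈s)) s≤g)
      in ≼-≈-trans h≼L (≈-sym g≈L)

  IsHead-unique : ∀ {β g g′} → IsHead β g → IsHead β g′ → g ≈ g′
  IsHead-unique (g≼Δ , g≼β , greatest) (g′≼Δ , g′≼β , greatest′) =
    ≼∧length≥⇒≈ (greatest′ _ g≼Δ g≼β) (length-mono-≼ (greatest _ g′≼Δ g′≼β))

  IsHead-respʳ : ∀ {β g g′} → IsHead β g → g ≈ g′ → IsHead β g′
  IsHead-respʳ (g≼Δ , g≼β , greatest) e =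
    ≈-≼-trans (≈-sym e) g≼Δ , ≈-≼-trans (≈-sym e) g≼β , (λ h h≼Δ h≼β → ≼-≈-trans (greatest h h≼Δ h≼β) e)

  IsHead-respˡ : ∀ {β β′ g} → IsHead β g → β ≈ β′ → IsHead β′ g
  IsHead-respˡ (g≼Δ , g≼β , greatest) e =
    g≼Δ , ≼-≈-trans g≼β e , (λ h h≼Δ h≼β′ → greatest h h≼Δ (≼-≈-trans h≼β′ (≈-sym e)))

  IsHead⇒≈head : ∀ {β g} → IsHead β g → g ≈ head β
  IsHead⇒≈head {β} isHead = IsHead-unique isHead (head-IsHead β)

  ≈head⇒IsHead : ∀ {β g} → g ≈ head β → IsHead β g
  ≈head⇒IsHead {β} e = IsHead-respʳ (head-IsHead β) (≈-sym e)

  head-cong : ∀ {β β′} → β ≈ β′ → head β ≈ head β′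
  head-cong {β} {β′} e = IsHead-unique (IsHead-respˡ (head-IsHead β) e) (head-IsHead β′)

  -- With L = lcm(a, head(ab)) = a t, the cofactor t divides b and also Δ (as Δ ≼ a Δ),
  -- so t ≼ head b and head(ab) ≼ a · head b.
  head-++ : ∀ a b → Valid n a → head (a ++ b) ≈ head (a ++ head b)
  head-++ a b valid-a =
    let (_ , Hb≼b , Hb-greatest) = head-IsHead b
        (G≼Δ , G≼ab , G-greatest) = head-IsHead (a ++ b)
        (G′≼Δ , G′≼aHb , G′-greatest) = head-IsHead (a ++ head b)
        G′≼G = G-greatest _ G′≼Δ (≼-trans G′≼aHb (++-monoʳ-≼ a Hb≼b))
        (_ , (t , at≈L) , G≼L , least) = lcm a (head (a ++ b)) (a ++ b) (u≼u++v a) G≼ab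
        G≼aΔ = ≼-trans G≼Δ (Δ≼w++Δ n a valid-a)
        t≼Δ = ++-cancelˡ-≼ a (≈-≼-trans at≈L (least (a ++ Δ n) (u≼u++v a) G≼aΔ))
        t≼b = ++-cancelˡ-≼ a (≈-≼-trans at≈L (least (a ++ b) (u≼u++v a) G≼ab))
        G≼G′ = G′-greatest _ G≼Δ (≼-trans (≼-≈-trans G≼L (≈-sym at≈L)) (++-monoʳ-≼ a (Hb-greatest t t≼Δ t≼b)))
    in ≼∧length≥⇒≈ G≼G′ (length-mono-≼ G′≼G)

module NormalForms (n : ℕ) where

  open Congruence
  open Cancellation
  open Divisibility
  open GarsideElement
  open Decidability
  open Heads n

  LeftDivides⇒≼ : ∀ {a b} → LeftDivides n a b → a ≼ b
  LeftDivides⇒≼ (c , _ , e) = c , e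

  ≼⇒LeftDivides : ∀ {a b} → Valid n b → a ≼ b → LeftDivides n a b
  ≼⇒LeftDivides valid-b a≼b = proj₁ a≼b , All-resp-≼-cofactor a≼b valid-b , proj₂ a≼b

  ≼Δ⇒Valid : ∀ {a} → a ≼ Δ n → Valid n a
  ≼Δ⇒Valid a≼Δ = All-resp-≼ a≼Δ (Δ-valid n)

  Simple⇒≼Δ : ∀ {x} → Simple n x → x ≼ Δ n
  Simple⇒≼Δ (_ , x≼Δ) = LeftDivides⇒≼ x≼Δ

  ≼Δ⇒Simple : ∀ {x} → x ≼ Δ n → Simple n x
  ≼Δ⇒Simple x≼Δ = ≼Δ⇒Valid x≼Δ , ≼⇒LeftDivides (Δ-valid n) x≼Δ

  IsLeftGcd⇒IsHead : ∀ {g β} → Valid n β → IsLeftGcd n g (Δ n) β → IsHead β g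
  IsLeftGcd⇒IsHead valid-β (g≼Δ , g≼β , greatest) =
    LeftDivides⇒≼ g≼Δ , LeftDivides⇒≼ g≼β ,
    λ h h≼Δ h≼β →
      LeftDivides⇒≼ (greatest h (≼Δ⇒Valid h≼Δ) (≼⇒LeftDivides (Δ-valid n) h≼Δ) (≼⇒LeftDivides valid-β h≼β))

  IsHead⇒IsLeftGcd : ∀ {g β} → Valid n β → IsHead β g → IsLeftGcd n g (Δ n) β
  IsHead⇒IsLeftGcd valid-β (g≼Δ , g≼β , greatest) =
    ≼⇒LeftDivides (Δ-valid n) g≼Δ , ≼⇒LeftDivides valid-β g≼β ,
    λ h _ h≼Δ h≼β → ≼⇒LeftDivides (≼Δ⇒Valid g≼Δ) (greatest h (LeftDivides⇒≼ h≼Δ) (LeftDivides⇒≼ h≼β))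

  NormalPair : Word → Word → Set
  NormalPair x y = IsHead (x ++ y) x

  NormalPair? : ∀ x y → Dec (NormalPair x y)
  NormalPair? x y with x ≈? head (x ++ y)
  ... | yes e = yes (≈head⇒IsHead e)
  ... | no ¬e = no (λ p → ¬e (IsHead⇒≈head p))

  NormalPair-resp-≈ : ∀ {x y x′ y′} → x ≈ x′ → y ≈ y′ → NormalPair x y → NormalPair x′ y′
  NormalPair-resp-≈ {x} {y} {x′} ex ey p = IsHead-respʳ (IsHead-respˡ p (++-congʳ y ex ⟨≈⟩ ++-congˡ x′ ey)) ex

  NormalChain : ∀ {d} → Vec Word d → Set
  NormalChain []           = ⊤
  NormalChain (x ∷ [])     = x ≼ Δ n
  NormalChain (x ∷ y ∷ ys) = x ≼ Δ n × NormalPair x y × NormalChain (y ∷ ys)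

  NormalChain-head : ∀ {d} x (xs : Vec Word d) → NormalChain (x ∷ xs) → x ≼ Δ n
  NormalChain-head x []      x≼Δ           = x≼Δ
  NormalChain-head x (_ ∷ _) (x≼Δ , _ , _) = x≼Δ

  NormalChain-tail : ∀ {d} x (xs : Vec Word d) → NormalChain (x ∷ xs) → NormalChain xs
  NormalChain-tail x []      _           = tt
  NormalChain-tail x (_ ∷ _) (_ , _ , c) = c

  NormalChain-valid : ∀ {d} (xs : Vec Word d) → NormalChain xs → Valid n (prod xs)
  NormalChain-valid []           _             = []
  NormalChain-valid (x ∷ [])     x≼Δ           = ++⁺ (≼Δ⇒Valid x≼Δ) []
  NormalChain-valid (x ∷ y ∷ ys) (x≼Δ , _ , c) = ++⁺ (≼Δ⇒Valid x≼Δ) (NormalChain-valid (y ∷ ys) c)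

  IsHead-++-head : ∀ {x y P} → Valid n x → IsHead P y → IsHead (x ++ P) x ⇔ NormalPair x y
  IsHead-++-head {x} {y} {P} valid-x y-head =
    mk⇔ (λ p → ≈head⇒IsHead (IsHead⇒≈head p ⟨≈⟩ head-++ x P valid-x ⟨≈⟩ head-cong x·P≈x·y))
        (λ p → ≈head⇒IsHead (IsHead⇒≈head p ⟨≈⟩ ≈-sym (head-++ x P valid-x ⟨≈⟩ head-cong x·P≈x·y)))
    where
    x·P≈x·y : x ++ head P ≈ x ++ y
    x·P≈x·y = ++-congˡ x (≈-sym (IsHead⇒≈head y-head))

  NormalChain⇒IsHead : ∀ {d} x (xs : Vec Word d) → NormalChain (x ∷ xs) → IsHead (prod (x ∷ xs)) x
  NormalChain⇒IsHead x []       x≼Δ = x≼Δ , ([] , ≈-refl) , λ h _ h≼x++[] → ≼-≈-trans h≼x++[] (≡⇒≈ (++-identityʳ x))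
  NormalChain⇒IsHead x (y ∷ ys) (x≼Δ , p , c) =
    Equivalence.from (IsHead-++-head (≼Δ⇒Valid x≼Δ) (NormalChain⇒IsHead y ys c)) p

  NormalChain⇒Normal : ∀ {d} (xs : Vec Word d) → NormalChain xs → Normal n xs
  NormalChain⇒Normal []       _ = tt
  NormalChain⇒Normal (x ∷ xs) c =
    ≼Δ⇒Simple (NormalChain-head x xs c) ,
    IsHead⇒IsLeftGcd (NormalChain-valid (x ∷ xs) c) (NormalChain⇒IsHead x xs c) ,
    NormalChain⇒Normal xs (NormalChain-tail x xs c)

  Normal⇒NormalChain : ∀ {d} (xs : Vec Word d) → Normal n xs → NormalChain xs
  Normal⇒NormalChain []           _ = tt
  Normal⇒NormalChain (x ∷ [])     (simple , _ , _) = Simple⇒≼Δ simple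
  Normal⇒NormalChain (x ∷ y ∷ ys) ((valid-x , x≼Δ) , gcd , normal) =
    let c = Normal⇒NormalChain (y ∷ ys) normal
        x-head = IsLeftGcd⇒IsHead (++⁺ valid-x (NormalChain-valid (y ∷ ys) c)) gcd
    in LeftDivides⇒≼ x≼Δ , Equivalence.to (IsHead-++-head valid-x (NormalChain⇒IsHead y ys c)) x-head , c

  _≋_ : ∀ {d} → Vec Word d → Vec Word d → Set
  _≋_ = VecPointwise _≈_

  NormalChain-unique : ∀ {d} (xs ys : Vec Word d) → NormalChain xs → NormalChain ys → prod xs ≈ prod ys → xs ≋ ys
  NormalChain-unique []       []       _  _  _ = []
  NormalChain-unique (x ∷ xs) (y ∷ ys) cx cy e =
    let x≈y = IsHead-unique (NormalChain⇒IsHead x xs cx) (IsHead-respˡ (NormalChain⇒IsHead y ys cy) (≈-sym e))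
    in x≈y ∷ NormalChain-unique xs ys (NormalChain-tail x xs cx) (NormalChain-tail y ys cy)
                                   (++-cancelˡ x (e ⟨≈⟩ ++-congʳ (prod ys) (≈-sym x≈y)))

  NormalChain-resp-≋ : ∀ {d} {xs ys : Vec Word d} → xs ≋ ys → NormalChain xs → NormalChain ys
  NormalChain-resp-≋ []                  _             = tt
  NormalChain-resp-≋ (e ∷ [])            x≼Δ           = ≈-≼-trans (≈-sym e) x≼Δ
  NormalChain-resp-≋ (e ∷ (e′ ∷ es))     (x≼Δ , p , c) =
    ≈-≼-trans (≈-sym e) x≼Δ , NormalPair-resp-≈ e e′ p , NormalChain-resp-≋ (e′ ∷ es) c

  prod-resp-≋ : ∀ {d} {xs ys : Vec Word d} → xs ≋ ys → prod xs ≈ prod ys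
  prod-resp-≋ []                              = ≈-refl
  prod-resp-≋ {xs = x ∷ xs} {y ∷ _} (e ∷ es) = ++-congʳ (prod xs) e ⟨≈⟩ ++-congˡ y (prod-resp-≋ es)

  last-resp-≋ : ∀ {d} {xs ys : Vec Word (suc d)} → xs ≋ ys → last xs ≈ last ys
  last-resp-≋ (e ∷ [])        = e
  last-resp-≋ (e ∷ (e′ ∷ es)) = last-resp-≋ (e′ ∷ es)

module Chains (n : ℕ) where

  open Congruence
  open Divisibility
  open ListFacts
  open Heads n
  open NormalForms n

  InSimples : ∀ {d} → Vec Word d → Set
  InSimples = VecAll (_∈ simples)

  InSimples-∷ʳ : ∀ {d} {xs : Vec Word d} {z} → InSimples xs → z ∈ simples → InSimples (xs ∷ʳ z)
  InSimples-∷ʳ []         z∈ = z∈ ∷ []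
  InSimples-∷ʳ (x∈ ∷ xs∈) z∈ = x∈ ∷ InSimples-∷ʳ xs∈ z∈

  InSimples-init : ∀ {d} (xs : Vec Word d) {z} → InSimples (xs ∷ʳ z) → InSimples xs
  InSimples-init []       _          = []
  InSimples-init (x ∷ xs) (x∈ ∷ xs∈) = x∈ ∷ InSimples-init xs xs∈

  InSimples-last : ∀ {d} {xs : Vec Word (suc d)} → InSimples xs → last xs ∈ simples
  InSimples-last (x∈ ∷ [])         = x∈
  InSimples-last (_ ∷ xs∈@(_ ∷ _)) = InSimples-last xs∈

  NormalChain-∷ʳ : ∀ {d} (xs : Vec Word (suc d)) {z} →
                   NormalChain xs → NormalPair (last xs) z → z ≼ Δ n → NormalChain (xs ∷ʳ z)
  NormalChain-∷ʳ (x ∷ [])     x≼Δ           p z≼Δ = x≼Δ , p , z≼Δ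
  NormalChain-∷ʳ (x ∷ y ∷ ys) (x≼Δ , q , c) p z≼Δ = x≼Δ , q , NormalChain-∷ʳ (y ∷ ys) c p z≼Δ

  NormalChain-∷ʳ⁻ : ∀ {d} (xs : Vec Word (suc d)) {z} →
                    NormalChain (xs ∷ʳ z) → NormalChain xs × NormalPair (last xs) z
  NormalChain-∷ʳ⁻ (x ∷ [])     (x≼Δ , p , _) = x≼Δ , p
  NormalChain-∷ʳ⁻ (x ∷ y ∷ ys) (x≼Δ , q , c) =
    let (c′ , p) = NormalChain-∷ʳ⁻ (y ∷ ys) c in (x≼Δ , q , c′) , p

  chains : (k : ℕ) → Word → List (Vec Word (suc k))
  chains zero    z = (z ∷ []) ∷ []
  chains (suc k) z = concatMap (λ y → keepIf (NormalPair? y z) (map (_∷ʳ z) (chains k y))) simples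

  last-chains : ∀ k z → All (λ xs → last xs ≡ z) (chains k z)
  last-chains zero    z = refl ∷ []
  last-chains (suc k) z = All-concatMap _ simples (λ {y} _ → last-keep y)
    where
    last-keep : ∀ y → All (λ xs → last xs ≡ z) (keepIf (NormalPair? y z) (map (_∷ʳ z) (chains k y)))
    last-keep y with NormalPair? y z
    ... | yes _ = All.map⁺ (All.tabulate (λ {xs} _ → last-∷ʳ z xs))
    ... | no  _ = []

  chains-sound : ∀ k {z} → z ∈ simples → All (λ xs → NormalChain xs × InSimples xs) (chains k z)
  chains-sound zero    z∈ = (All.lookup simples-≼Δ z∈ , z∈ ∷ []) ∷ []
  chains-sound (suc k) {z} z∈ = All-concatMap _ simples sound-keep
    where
    sound-keep : ∀ {y} → y ∈ simples →
                 All (λ xs → NormalChain xs × InSimples xs) (keepIf (NormalPair? y z) (map (_∷ʳ z) (chains k y)))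
    sound-keep {y} y∈ with NormalPair? y z
    ... | no  _ = []
    ... | yes p = All.map⁺ (All.zipWith extend (chains-sound k y∈ , last-chains k y))
      where
      extend : ∀ {xs} → (NormalChain xs × InSimples xs) × last xs ≡ y → NormalChain (xs ∷ʳ z) × InSimples (xs ∷ʳ z)
      extend {xs} ((c , xs∈) , refl) = NormalChain-∷ʳ xs c p (All.lookup simples-≼Δ z∈) , InSimples-∷ʳ xs∈ z∈

  chains-complete : ∀ k (xs : Vec Word (suc k)) → NormalChain xs → InSimples xs → xs ∈ chains k (last xs)
  chains-complete zero    (x ∷ []) _ _ = here refl
  chains-complete (suc k) xs c xs∈ with initLast xs
  ... | ys , z , refl =
    ∈-concatMap⁺ (λ y → keepIf (NormalPair? y z) (map (_∷ʳ z) (chains k y)))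
      (Any.map (λ { refl → keep }) (InSimples-last ys∈))
    where
    ys∈ = InSimples-init ys xs∈
    keep : ys ∷ʳ z ∈ keepIf (NormalPair? (last ys) z) (map (_∷ʳ z) (chains k (last ys)))
    keep with NormalPair? (last ys) z | NormalChain-∷ʳ⁻ ys c
    ... | yes _ | (c′ , _) = ∈-map⁺ (_∷ʳ z) (chains-complete k ys c′ ys∈)
    ... | no ¬p | (_ , p)  = ⊥-elim (¬p p)

  All-representatives : ∀ {d} {xs : Vec Word d} → VecAll (_≼ Δ n) xs → Σ (Vec Word d) λ ys → xs ≋ ys × InSimples ys
  All-representatives []             = [] , [] , []
  All-representatives (x≼Δ ∷ xs≼Δ) =
    let (s , s∈ , x≈s) = find (simples-complete x≼Δ)
        (ys , xs≋ys , ys∈) = All-representatives xs≼Δ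
    in s ∷ ys , x≈s ∷ xs≋ys , s∈ ∷ ys∈

  NormalChain-simple : ∀ {d} (xs : Vec Word d) → NormalChain xs → VecAll (_≼ Δ n) xs
  NormalChain-simple []       _ = []
  NormalChain-simple (x ∷ xs) c = NormalChain-head x xs c ∷ NormalChain-simple xs (NormalChain-tail x xs c)

  ≋⇒≡ : ∀ {d} {xs ys : Vec Word d} → xs ≋ ys → InSimples xs → InSimples ys → xs ≡ ys
  ≋⇒≡ []       _          _          = refl
  ≋⇒≡ (e ∷ es) (x∈ ∷ xs∈) (y∈ ∷ ys∈) = cong₂ _∷_ (simples-≈⇒≡ x∈ y∈ e) (≋⇒≡ es xs∈ ys∈)

  chains-unique : ∀ k z → AllPairs _≢_ (chains k z)
  chains-unique zero    z = [] ∷ []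
  chains-unique (suc k) z =
    Unique-concatMap (λ xs → last (init xs)) _ simples (AllPairs.map (λ y≉y′ y≡y′ → y≉y′ (≡⇒≈ y≡y′)) simples-unique)
                     keep-unique keep-key
    where
    keep-unique : ∀ y → AllPairs _≢_ (keepIf (NormalPair? y z) (map (_∷ʳ z) (chains k y)))
    keep-unique y with NormalPair? y z
    ... | yes _ = AllPairs.map⁺ (AllPairs.map (λ xs≢ys e → xs≢ys (∷ʳ-injectiveˡ _ _ e)) (chains-unique k y))
    ... | no  _ = []
    keep-key : ∀ y → All (λ xs → last (init xs) ≡ y) (keepIf (NormalPair? y z) (map (_∷ʳ z) (chains k y)))
    keep-key y with NormalPair? y z
    ... | yes _ = All.map⁺ (All.map (λ {xs} last≡ → trans (cong last (init-∷ʳ z xs)) last≡) (last-chains k y))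
    ... | no  _ = []

module Counting (n : ℕ) where

  open import Data.Integer using (ℤ; +_; _+_; _*_; 0ℤ; 1ℤ)
  import Data.Integer.Properties as ℤ
  open Congruence
  open ListFacts
  open LinearAlgebra {Word}
  open PowerSeries using (recurrence⇒IsRational)
  open Heads n
  open NormalForms n
  open Chains n

  prod-unique : ∀ {d} (L : List (Vec Word d)) → AllPairs _≢_ L → All (λ xs → NormalChain xs × InSimples xs) L →
                AllPairs (λ a b → ¬ a ≈ b) (map prod L)
  prod-unique []       _            _                  = []
  prod-unique (xs ∷ L) (xs∉L ∷ uL) ((c , xs∈) ∷ sound) =
    All.map⁺ (All.zipWith (λ {ys} (xs≢ys , (c′ , ys∈)) e → xs≢ys (≋⇒≡ (NormalChain-unique xs ys c c′ e) xs∈ ys∈))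
                          (xs∉L , sound))
    ∷ prod-unique L uL sound

  chains-IsCount : ∀ k {x x*} → x* ∈ simples → x ≈ x* → IsCount n (DegLeWithLast n k x) (length (chains k x*))
  chains-IsCount k {x} {x*} x*∈ x≈x* =
    map prod (chains k x*) , length-map prod (chains k x*) , members ,
    prod-unique (chains k x*) (chains-unique k x*) (chains-sound k x*∈) , complete
    where
    members : All (λ w → Valid n w × DegLeWithLast n k x w) (map prod (chains k x*))
    members = All.map⁺ (All.zipWith (λ {xs} ((c , _) , last≡x*) →
                NormalChain-valid xs c , xs , NormalChain⇒Normal xs c , ≈-refl , (≡⇒≈ last≡x* ⟨≈⟩ ≈-sym x≈x*))
              (chains-sound k x*∈ , last-chains k x*))
    complete : ∀ w → Valid n w → DegLeWithLast n k x w → Any (w ≈_) (map prod (chains k x*))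
    complete w _ (xs , normal , xs≈w , last≈x) =
      let c = Normal⇒NormalChain xs normal
          (ys , xs≋ys , ys∈) = All-representatives (NormalChain-simple xs c)
          last≡x* = simples-≈⇒≡ (InSimples-last ys∈) x*∈ (≈-sym (last-resp-≋ xs≋ys) ⟨≈⟩ last≈x ⟨≈⟩ x≈x*)
          ys∈chains = subst (λ t → ys ∈ chains k t) last≡x* (chains-complete k ys (NormalChain-resp-≋ xs≋ys c) ys∈)
      in Any.map (λ { refl → ≈-sym xs≈w ⟨≈⟩ prod-resp-≋ xs≋ys }) (∈-map⁺ prod ys∈chains)

  transition : Word → Word → ℤ
  transition y z with NormalPair? y z
  ... | yes _ = 1ℤ
  ... | no  _ = 0ℤ

  count : ℕ → Word → ℤ
  count k z = + length (chains k z)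

  length-concatMap : ∀ {B : Set} (f : Word → List B) xs → + length (concatMap f xs) ≡ sumOver xs (λ y → + length (f y))
  length-concatMap f []       = refl
  length-concatMap f (y ∷ xs) =
    trans (cong +_ (length-++ (f y))) (trans (ℤ.pos-+ (length (f y)) _) (cong (_+_ (+ length (f y))) (length-concatMap f xs)))

  count-suc : ∀ k z → count (suc k) z ≡ sumOver simples (λ y → transition y z * count k y)
  count-suc k z = trans (length-concatMap _ simples) (sumOver-cong simples length-keep)
    where
    length-keep : ∀ y → + length (keepIf (NormalPair? y z) (map (_∷ʳ z) (chains k y))) ≡ transition y z * count k y
    length-keep y with NormalPair? y z
    ... | yes _ = trans (cong +_ (length-map (_∷ʳ z) (chains k y))) (sym (ℤ.*-identityˡ (count k y)))
    ... | no  _ = sym (ℤ.*-zeroˡ (count k y))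

  degreeCounts : Word → ℕ → ℕ
  degreeCounts z zero    = 0
  degreeCounts z (suc k) = length (chains k z)

  degreeCounts-rational : ∀ {z} → z ∈ simples → IsRational (seriesFrom1 (degreeCounts z))
  degreeCounts-rational {z} z∈ =
    let (Q , nt , recur) = Iteration.recurrence simples transition count count-suc z z∈
    in recurrence⇒IsRational (seriesFrom1 (degreeCounts z)) refl Q nt (length simples) recur

corollary2p10 : (n : ℕ) → 1 ≤ n → (x : Defs.Word) → Simple n x →
    Σ (ℕ → ℕ) λ b →
    (∀ k → IsCount n (DegLeWithLast n k x) (b (suc k))) ×
    IsRational (seriesFrom1 b)
corollary2p10 n _ x simple-x =
  let (x* , x*∈simples , x≈x*) = find (simples-complete (Simple⇒≼Δ simple-x))
  in degreeCounts x* , (λ k → chains-IsCount k x*∈simples x≈x*) , degreeCounts-rational x*∈simples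
  where
  open Heads n using (simples-complete)
  open NormalForms n using (Simple⇒≼Δ)
  open Counting n
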